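{- Let $m \ge 1$ and $k = 2m+3$. A connected graph $G$ is an $SC_k$ graph if and only if, in its decomposition along clique separators of size one and two, every piece is either a single edge ($K_2$, arising as a cut edge) or a cycle $C_k$.
   Context: All graphs are finite, simple and undirected. A graph $G$ is an $SC_k$ graph if either $G$ has no cycle, or every induced cycle of $G$ has length exactly $k$. The decomposition of $G$ along clique separators of size one and two is obtained as follows: first split $G$ into its bi-connected components (maximal subgraphs with no cut vertex; a cut edge forms its own component $K_2$); then, repeatedly, whenever a piece $H$ contains an edge $\{u,v\}$ such that $H-\{u,v\}$ is disconnected, replace $H$ by the graphs induced on $C\cup\{u,v\}$ for each connected component $C$ of $H-\{u,v\}$ (so the edge $\{u,v\}$ is kept in each new piece); stop when no piece has such a cut vertex or separating edge. -}

module Defs where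

open import Data.Nat using (ℕ; zero; suc; _≤_)
open import Data.Fin using (Fin; toℕ)
open import Data.Fin.Subset using (Subset; _∈_; _∉_; _⊆_; _∪_; _─_; ⁅_⁆; Nonempty)
open import Data.Bool using (Bool; true; false)
open import Data.List using (List; []; _∷_; _++_)
open import Data.List.Membership.Propositional using () renaming (_∈_ to _∈ˡ_)
open import Data.Product using (Σ; ∃; ∃-syntax; _×_; _,_)
open import Data.Sum using (_⊎_)
open import Relation.Nullary using (¬_)
open import Relation.Binary.PropositionalEquality using (_≡_; _≢_)
open import Function.Definitions using (Injective)
open import Function.Bundles using (_⇔_)

record Graph (n : ℕ) : Set where
  field
    adj     : Fin n → Fin n → Bool
    adj-sym : ∀ x y → adj x y ≡ adj y x
    adj-irr : ∀ x → adj x x ≡ false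

module _ {n : ℕ} (G : Graph n) where
  open Graph G

  Edge : Fin n → Fin n → Set
  Edge x y = adj x y ≡ true

  CycAdj : ∀ {ℓ} → Fin ℓ → Fin ℓ → Set
  CycAdj {ℓ} i j =
      toℕ j ≡ suc (toℕ i)
    ⊎ toℕ i ≡ suc (toℕ j)
    ⊎ (toℕ i ≡ 0 × suc (toℕ j) ≡ ℓ)
    ⊎ (toℕ j ≡ 0 × suc (toℕ i) ≡ ℓ)

  IsCycle : (ℓ : ℕ) → (Fin ℓ → Fin n) → Set
  IsCycle ℓ f = 3 ≤ ℓ × Injective _≡_ _≡_ f
              × (∀ i j → CycAdj i j → Edge (f i) (f j))

  IsInducedCycle : (ℓ : ℕ) → (Fin ℓ → Fin n) → Set
  IsInducedCycle ℓ f = 3 ≤ ℓ × Injective _≡_ _≡_ f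
                     × (∀ i j → Edge (f i) (f j) ⇔ CycAdj i j)

  HasCycle : Set
  HasCycle = ∃[ ℓ ] Σ (Fin ℓ → Fin n) (IsCycle ℓ)

  SC : ℕ → Set
  SC k = ¬ HasCycle ⊎ (∀ ℓ (f : Fin ℓ → Fin n) → IsInducedCycle ℓ f → ℓ ≡ k)

  data Reach (S : Subset n) : Fin n → Fin n → Set where
    here : ∀ {x} → x ∈ S → Reach S x x
    step : ∀ {x y z} → x ∈ S → Edge x y → Reach S y z → Reach S x z

  Connected : Subset n → Set
  Connected S = ∀ x y → x ∈ S → y ∈ S → Reach S x y

  NoCutVertex : Subset n → Set
  NoCutVertex S = Connected S × (∀ x → x ∈ S → Connected (S ─ ⁅ x ⁆))

  Block : Subset n → Set
  Block S = NoCutVertex S × (∀ T → S ⊆ T → NoCutVertex T → T ⊆ S)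

  Component : Subset n → Subset n → Set
  Component R C = Nonempty C × C ⊆ R × Connected C
                × (∀ T → C ⊆ T → T ⊆ R → Connected T → T ⊆ C)

  SepEdge : Subset n → Fin n → Fin n → Set
  SepEdge H u v = u ∈ H × v ∈ H × Edge u v × ¬ Connected (H ─ (⁅ u ⁆ ∪ ⁅ v ⁆))

  -- Decomposition along clique separators of size one and two.
  -- A state is the list of current pieces (vertex sets of induced subgraphs).

  data Reachable : List (Subset n) → Set where
    start : ∀ L → (∀ S → S ∈ˡ L ⇔ Block S) → Reachable L
    split : ∀ L₁ H L₂ u v M → Reachable (L₁ ++ H ∷ L₂) → SepEdge H u v
          → (∀ S → S ∈ˡ M ⇔ (∃[ C ] Component (H ─ (⁅ u ⁆ ∪ ⁅ v ⁆)) C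
                                      × S ≡ C ∪ (⁅ u ⁆ ∪ ⁅ v ⁆)))
          → Reachable (L₁ ++ M ++ L₂)

  Final : List (Subset n) → Set
  Final L = ∀ H → H ∈ˡ L →
              (∀ x → x ∈ H → Connected (H ─ ⁅ x ⁆))
            × (∀ u v → ¬ SepEdge H u v)

  Decomposition : List (Subset n) → Set
  Decomposition L = Reachable L × Final L

  IsK2 : Subset n → Set
  IsK2 H = ∃[ u ] ∃[ v ] u ≢ v × Edge u v × H ≡ ⁅ u ⁆ ∪ ⁅ v ⁆

  IsCk : ℕ → Subset n → Set
  IsCk k H = Σ (Fin k → Fin n) λ f → IsInducedCycle k f
               × (∀ x → x ∈ H ⇔ (∃[ i ] f i ≡ x))

module Submission where

-- (⇒) The key fact is that, in an SC_k graph with k odd and k ≠ 3, no induced cycle has an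
-- ear, i.e. an induced path outside the cycle joining two non-adjacent cycle vertices (Ears):
-- the cycles formed by a shortest ear with the two arcs cannot all have the odd length k.
-- Every piece of the decomposition is connected with at least two vertices (Splitting); a
-- final piece with a third vertex contains an induced cycle, and a further vertex would be
-- attached to that cycle by an ear, so the piece is the cycle (FinalPieces).
-- (⇐) holds for every graph and every k: a decomposition exists (Existence), every induced
-- cycle lies in some final piece (Survival), and an induced cycle inside a K₂ or a C_k
-- piece is impossible or has length k (CycleLength).

module Parity where

  open import Data.Nat using (zero; suc; _≤_; _+_; _*_)
  open import Data.Nat.Properties using (+-suc; suc-injective)
  open import Data.Nat.Tactic.RingSolver using (solve-∀)
  open import Relation.Binary.PropositionalEquality using (_≡_; _≢_; sym; trans)

  even≢odd : ∀ q p → q + q ≢ suc (p + p)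
  even≢odd (suc q) zero e with trans (sym (+-suc q q)) (suc-injective e)
  ... | ()
  even≢odd (suc q) (suc p) e =
    even≢odd q p (suc-injective (trans (sym (+-suc q q)) (trans (suc-injective e) (+-suc (suc p) p))))

  2m+3≡odd : ∀ m → 2 * m + 3 ≡ suc (suc m + suc m)
  2m+3≡odd = solve-∀

  2m+3-odd : ∀ m q → q + q ≢ 2 * m + 3
  2m+3-odd m q e = even≢odd q (suc m) (trans e (2m+3≡odd m))

  2m+5≡5+even : ∀ m → 2 * suc m + 3 ≡ 5 + (m + m)
  2m+5≡5+even = solve-∀

  2m+3≢3 : ∀ m → 1 ≤ m → 2 * m + 3 ≢ 3
  2m+3≢3 (suc m) _ e with trans (sym (2m+5≡5+even m)) e
  ... | ()

module Basics where

  open import Defs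
  open import Data.Nat using (ℕ; suc; _<_; s≤s)
  open import Data.Nat.Properties using (<-≤-trans; ≤-refl)
  open import Data.Fin using (Fin; _≟_)
  open import Data.Fin.Subset using (Subset; _∈_; _∉_; _⊆_; _∪_; _─_; ⁅_⁆; ∣_∣; inside; outside)
  open import Data.Fin.Subset.Properties
    using (x∈p∧x∉q⇒x∈p─q; p─q⊆p; x∈p∪q⁻; x∈p∪q⁺; x∈⁅x⁆; x∈⁅y⁆⇒x≡y; x≢y⇒x∉⁅y⁆; x∈p⇒∣p-x∣<∣p∣; _∈?_)
  open import Data.Fin.Properties using (any?; all?)
  open import Data.Vec using (_∷_; tabulate)
  open import Data.Vec.Properties using (lookup∘tabulate; []=⇒lookup; lookup⇒[]=)
  open import Relation.Nullary.Decidable using (does; dec-true)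
  open import Relation.Unary using (Decidable)
  open import Data.Vec.Base using (here; there)
  open import Data.Bool using (true)
  import Data.Bool as Bool
  open import Data.Product using (∃; _×_; _,_; proj₂)
  open import Data.Sum using (_⊎_; inj₁; inj₂)
  open import Relation.Nullary using (¬_; Dec; yes; no; _×-dec_; _→-dec_)
  open import Relation.Binary.PropositionalEquality using (_≡_; _≢_; refl; sym; trans)

  ∈─⁻ : ∀ {n} {x : Fin n} (p q : Subset n) → x ∈ p ─ q → x ∈ p × x ∉ q
  ∈─⁻ (inside ∷ p) (outside ∷ q) here = here , λ ()
  ∈─⁻ (b ∷ p) (inside ∷ q) (there h) with ∈─⁻ p q h
  ... | a , c = there a , λ { (there z) → c z }
  ∈─⁻ (b ∷ p) (outside ∷ q) (there h) with ∈─⁻ p q h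
  ... | a , c = there a , λ { (there z) → c z }

  ∈─⁅⁆⁻ : ∀ {n} {x y : Fin n} {p : Subset n} → x ∈ p ─ ⁅ y ⁆ → x ∈ p × x ≢ y
  ∈─⁅⁆⁻ {y = y} {p} h with ∈─⁻ p ⁅ y ⁆ h
  ... | x∈p , x∉y = x∈p , λ { refl → x∉y (x∈⁅x⁆ y) }

  ∈─⁅⁆⁺ : ∀ {n} {x y : Fin n} {p : Subset n} → x ∈ p → x ≢ y → x ∈ p ─ ⁅ y ⁆
  ∈─⁅⁆⁺ x∈p x≢y = x∈p∧x∉q⇒x∈p─q x∈p (x≢y⇒x∉⁅y⁆ x≢y)

  ∈uv⁻ : ∀ {n} {x u v : Fin n} → x ∈ ⁅ u ⁆ ∪ ⁅ v ⁆ → x ≡ u ⊎ x ≡ v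
  ∈uv⁻ {u = u} {v} h with x∈p∪q⁻ ⁅ u ⁆ ⁅ v ⁆ h
  ... | inj₁ z = inj₁ (x∈⁅y⁆⇒x≡y u z)
  ... | inj₂ z = inj₂ (x∈⁅y⁆⇒x≡y v z)

  ∈uv⁺ : ∀ {n} {x u v : Fin n} → x ≡ u ⊎ x ≡ v → x ∈ ⁅ u ⁆ ∪ ⁅ v ⁆
  ∈uv⁺ {u = u} (inj₁ refl) = x∈p∪q⁺ (inj₁ (x∈⁅x⁆ u))
  ∈uv⁺ {v = v} (inj₂ refl) = x∈p∪q⁺ (inj₂ (x∈⁅x⁆ v))

  ∈─uv⁻ : ∀ {n} {x u v : Fin n} {p : Subset n} → x ∈ p ─ (⁅ u ⁆ ∪ ⁅ v ⁆) → x ∈ p × x ≢ u × x ≢ v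
  ∈─uv⁻ {p = p} h with ∈─⁻ p _ h
  ... | x∈p , x∉uv = x∈p , (λ e → x∉uv (∈uv⁺ (inj₁ e))) , (λ e → x∉uv (∈uv⁺ (inj₂ e)))

  ∈─uv⁺ : ∀ {n} {x u v : Fin n} {p : Subset n} → x ∈ p → x ≢ u → x ≢ v → x ∈ p ─ (⁅ u ⁆ ∪ ⁅ v ⁆)
  ∈─uv⁺ x∈p x≢u x≢v = x∈p∧x∉q⇒x∈p─q x∈p λ h → [ x≢u , x≢v ] (∈uv⁻ h)
    where open import Data.Sum using ([_,_])

  ∈∪uv⁻ : ∀ {n} {x u v : Fin n} (C : Subset n) → x ∈ C ∪ (⁅ u ⁆ ∪ ⁅ v ⁆) → x ∈ C ⊎ x ≡ u ⊎ x ≡ v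
  ∈∪uv⁻ C h with x∈p∪q⁻ C _ h
  ... | inj₁ z = inj₁ z
  ... | inj₂ z = inj₂ (∈uv⁻ z)

  ∈∪uv⁺ : ∀ {n} {x u v : Fin n} {C : Subset n} → x ∈ C ⊎ x ≡ u ⊎ x ≡ v → x ∈ C ∪ (⁅ u ⁆ ∪ ⁅ v ⁆)
  ∈∪uv⁺ (inj₁ h) = x∈p∪q⁺ (inj₁ h)
  ∈∪uv⁺ (inj₂ h) = x∈p∪q⁺ (inj₂ (∈uv⁺ h))

  subsetOf : ∀ {n} {P : Fin n → Set} → Decidable P → Subset n
  subsetOf P? = tabulate (λ x → does (P? x))

  subsetOf⁺ : ∀ {n} {P : Fin n → Set} (P? : Decidable P) {x} → P x → x ∈ subsetOf P?
  subsetOf⁺ P? {x} px = lookup⇒[]= x _ (trans (lookup∘tabulate _ x) (dec-true (P? x) px))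

  subsetOf⁻ : ∀ {n} {P : Fin n → Set} (P? : Decidable P) {x} → x ∈ subsetOf P? → P x
  subsetOf⁻ P? {x} h with P? x | trans (sym (lookup∘tabulate (λ z → does (P? z)) x)) ([]=⇒lookup h)
  ... | yes px | _ = px
  ... | no _ | ()

  module _ {n : ℕ} (G : Graph n) where
    open Graph G

    Edge? : ∀ x y → Dec (Edge G x y)
    Edge? x y = adj x y Bool.≟ true

    Edge-sym : ∀ {x y} → Edge G x y → Edge G y x
    Edge-sym {x} {y} e = trans (sym (adj-sym x y)) e

    Edge-irr : ∀ {x} → ¬ Edge G x x
    Edge-irr {x} e with trans (sym (adj-irr x)) e
    ... | ()

    Edge-≢ : ∀ {x y} → Edge G x y → x ≢ y
    Edge-≢ e refl = Edge-irr e

    reach-start : ∀ {S x y} → Reach G S x y → x ∈ S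
    reach-start (here h) = h
    reach-start (step h _ _) = h

    reach-end : ∀ {S x y} → Reach G S x y → y ∈ S
    reach-end (here h) = h
    reach-end (step _ _ r) = reach-end r

    reach-mono : ∀ {S T x y} → S ⊆ T → Reach G S x y → Reach G T x y
    reach-mono st (here h) = here (st h)
    reach-mono st (step h e r) = step (st h) e (reach-mono st r)

    reach-trans : ∀ {S x y z} → Reach G S x y → Reach G S y z → Reach G S x z
    reach-trans (here _) r = r
    reach-trans (step h e r) r' = step h e (reach-trans r r')

    reach-snoc : ∀ {S x y z} → Reach G S x y → Edge G y z → z ∈ S → Reach G S x z
    reach-snoc r e hz = reach-trans r (step (reach-end r) e (here hz))

    reach-sym : ∀ {S x y} → Reach G S x y → Reach G S y x
    reach-sym (here h) = here h
    reach-sym (step h e r) = reach-snoc (reach-sym r) (Edge-sym e) h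

    reach-edge : ∀ {S x y} → x ∈ S → y ∈ S → Edge G x y → Reach G S x y
    reach-edge hx hy e = step hx e (here hy)

    lastVisit : ∀ {S w y} x → Reach G S w y → x ∈ S →
                Reach G (S ─ ⁅ x ⁆) w y ⊎ (x ≡ y ⊎ ∃ λ z → Edge G x z × Reach G (S ─ ⁅ x ⁆) z y)
    lastVisit {w = w} x (here h) hx with w ≟ x
    ... | yes refl = inj₂ (inj₁ refl)
    ... | no ne = inj₁ (here (∈─⁅⁆⁺ h ne))
    lastVisit {w = w} x (step {y = w'} h e r) hx with lastVisit x r hx | w ≟ x
    ... | inj₁ av | yes refl = inj₂ (inj₂ (w' , e , av))
    ... | inj₁ av | no ne = inj₁ (step (∈─⁅⁆⁺ h ne) e av)
    ... | inj₂ q | _ = inj₂ q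

    -- Reachability is decided by recursion on the size of S: a walk from x ≠ y leaves x
    -- along an edge and, after its last visit to x, stays inside S ─ {x}.
    reach?-by-size : ∀ bound (S : Subset n) → ∣ S ∣ < bound → ∀ x y → Dec (Reach G S x y)
    reach?-by-size (suc bound) S (s≤s lt) x y with x ∈? S
    ... | no x∉S = no λ r → x∉S (reach-start r)
    ... | yes x∈S with x ≟ y
    ...   | yes refl = yes (here x∈S)
    ...   | no x≢y with any? (λ z → Edge? x z ×-dec
                                  reach?-by-size bound (S ─ ⁅ x ⁆) (<-≤-trans (x∈p⇒∣p-x∣<∣p∣ x∈S) lt) z y)
    ...     | yes (z , e , r) = yes (step x∈S e (reach-mono (p─q⊆p S _) r))
    ...     | no none = no λ r → lastLeave (lastVisit x r x∈S)
      where
      lastLeave : ¬ (Reach G (S ─ ⁅ x ⁆) x y ⊎ (x ≡ y ⊎ ∃ λ z → Edge G x z × Reach G (S ─ ⁅ x ⁆) z y))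
      lastLeave (inj₁ r') = proj₂ (∈─⁅⁆⁻ (reach-start r')) refl
      lastLeave (inj₂ (inj₁ e)) = x≢y e
      lastLeave (inj₂ (inj₂ w)) = none w

    Reach? : ∀ S x y → Dec (Reach G S x y)
    Reach? S x y = reach?-by-size (suc ∣ S ∣) S ≤-refl x y

    Connected? : ∀ S → Dec (Connected G S)
    Connected? S with all? (λ x → all? (λ y → (x ∈? S) →-dec ((y ∈? S) →-dec Reach? S x y)))
    ... | yes f = yes λ x y hx hy → f x y hx hy
    ... | no nf = no λ c → nf λ x y hx hy → c x y hx hy

-- Induced paths and induced cycles represented as lists of vertices.  Lists make cutting,
-- gluing, reversing and rotating cycles easy; the correspondence with the function
-- representation 'IsInducedCycle' of Defs is established in CycleLists.
module Paths where

  open import Defs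
  open Basics
  open import Data.Nat using (ℕ; zero; suc)
  open import Data.Fin using (Fin; zero; suc)
  open import Data.List using (List; []; _∷_; _++_; reverse; [_])
  open import Data.List.Properties using (++-assoc; unfold-reverse)
  open import Data.List.Relation.Unary.All using (All; []; _∷_) renaming (lookup to All-lookup; tabulate to All-tab; map to All-map)
  import Data.List.Relation.Unary.All.Properties as AllP
  open import Data.List.Relation.Unary.Any using (Any; here; there)
  open import Data.List.Relation.Unary.Any.Properties using (reverse⁻)
  open import Data.List.Membership.Propositional using () renaming (_∈_ to _∈ˡ_; _∉_ to _∉ˡ_)
  open import Data.List.Membership.Propositional.Properties using (∈-++⁺ˡ; ∈-++⁺ʳ; ∈-++⁻)
  open import Data.Product using (∃; _×_; _,_)
  open import Data.Sum using (inj₁; inj₂)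
  open import Data.Empty using (⊥; ⊥-elim)
  open import Data.Unit using (⊤; tt)
  open import Relation.Nullary using (¬_; yes; no)
  open import Relation.Unary using (Decidable)
  open import Relation.Binary.PropositionalEquality using (_≡_; refl; sym; trans; cong; subst)

  ∉-mid : ∀ {A : Set} {x y : A} as {ys} → x ∉ˡ as ++ [ y ] → x ∉ˡ ys → x ∉ˡ as ++ y ∷ ys
  ∉-mid as h1 h2 m with ∈-++⁻ as m
  ... | inj₁ m' = h1 (∈-++⁺ˡ m')
  ... | inj₂ (here refl) = h1 (∈-++⁺ʳ as (here refl))
  ... | inj₂ (there m') = h2 m'

  first : ∀ {A : Set} {P : A → Set} → Decidable P → ∀ xs → Any P xs →
          ∃ λ ys → ∃ λ x → ∃ λ zs → xs ≡ ys ++ x ∷ zs × P x × All (λ y → ¬ P y) ys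
  first P? (x ∷ xs) a with P? x
  ... | yes px = [] , x , xs , refl , px , []
  ... | no npx with a
  ...   | here px = ⊥-elim (npx px)
  ...   | there a' with first P? xs a'
  ...     | ys , y , zs , refl , py , al = x ∷ ys , y , zs , refl , py , npx ∷ al

  snocView : ∀ {A : Set} (x : A) xs → ∃ λ ys → ∃ λ l → x ∷ xs ≡ ys ++ [ l ]
  snocView x [] = [] , x , refl
  snocView x (y ∷ xs) with snocView y xs
  ... | ys , l , eq = x ∷ ys , l , cong (x ∷_) eq

  module _ {n : ℕ} (G : Graph n) where

    NoEdgeTo : Fin n → List (Fin n) → Set
    NoEdgeTo x ys = All (λ y → ¬ Edge G x y) ys

    Disjoint : List (Fin n) → List (Fin n) → Set
    Disjoint xs ys = All (λ x → x ∉ˡ ys) xs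

    NoEdges : List (Fin n) → List (Fin n) → Set
    NoEdges xs ys = All (λ x → NoEdgeTo x ys) xs

    IPath : List (Fin n) → Set
    IPath [] = ⊤
    IPath (x ∷ []) = ⊤
    IPath (x ∷ y ∷ ys) = Edge G x y × NoEdgeTo x ys × x ∉ˡ (y ∷ ys) × IPath (y ∷ ys)

    OnlyLast : Fin n → List (Fin n) → Set
    OnlyLast v [] = ⊥
    OnlyLast v (x ∷ []) = Edge G v x
    OnlyLast v (x ∷ y ∷ ys) = ¬ Edge G v x × OnlyLast v (y ∷ ys)

    Closes : Fin n → List (Fin n) → Set
    Closes v [] = ⊥
    Closes v (a ∷ q) = Edge G v a × OnlyLast v q

    ICycle : Fin n → List (Fin n) → Set
    ICycle v p = IPath p × v ∉ˡ p × Closes v p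

    NoEdgeTo-flip : ∀ {x ys} → NoEdgeTo x ys → All (λ y → ¬ Edge G y x) ys
    NoEdgeTo-flip [] = []
    NoEdgeTo-flip (h ∷ hs) = (λ e → h (Edge-sym G e)) ∷ NoEdgeTo-flip hs

    NoEdgeTo-unflip : ∀ {x ys} → All (λ y → ¬ Edge G y x) ys → NoEdgeTo x ys
    NoEdgeTo-unflip [] = []
    NoEdgeTo-unflip (h ∷ hs) = (λ e → h (Edge-sym G e)) ∷ NoEdgeTo-unflip hs

    ∉⇒Disjoint-[] : ∀ {x : Fin n} {ys : List (Fin n)} → x ∉ˡ ys → All (λ y → y ∉ˡ [ x ]) ys
    ∉⇒Disjoint-[] {ys = []} h = []
    ∉⇒Disjoint-[] {ys = y ∷ ys} h = (λ { (here refl) → h (here refl) }) ∷ ∉⇒Disjoint-[] (λ m → h (there m))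

    IPath-tail : ∀ {x xs} → IPath (x ∷ xs) → IPath xs
    IPath-tail {xs = []} h = tt
    IPath-tail {xs = y ∷ ys} (_ , _ , _ , h) = h

    IPath-head∉ : ∀ {x xs} → IPath (x ∷ xs) → x ∉ˡ xs
    IPath-head∉ {xs = []} h ()
    IPath-head∉ {xs = y ∷ ys} (_ , _ , h , _) = h

    IPath-last∉ : ∀ {b} (xs : List (Fin n)) → IPath (xs ++ [ b ]) → b ∉ˡ xs
    IPath-last∉ [] ip ()
    IPath-last∉ (x ∷ xs) ip (here refl) = IPath-head∉ ip (∈-++⁺ʳ xs (here refl))
    IPath-last∉ (x ∷ xs) ip (there m) = IPath-last∉ xs (IPath-tail ip) m

    IPath-++⁻ : ∀ (xs : List (Fin n)) {ys} → IPath (xs ++ ys) → IPath xs × IPath ys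
    IPath-++⁻ [] h = tt , h
    IPath-++⁻ (x ∷ []) h = tt , IPath-tail h
    IPath-++⁻ (x ∷ y ∷ xs) (e , na , nin , ip) with IPath-++⁻ (y ∷ xs) ip
    ... | a , b = (e , AllP.++⁻ˡ xs na , (λ m → nin (∈-++⁺ˡ m)) , a) , b

    IPath-++ : ∀ (xs : List (Fin n)) {y ys} → IPath (xs ++ [ y ]) → IPath (y ∷ ys) → Disjoint xs ys → NoEdges xs ys → IPath (xs ++ y ∷ ys)
    IPath-++ [] h1 h2 d ne = h2
    IPath-++ (x ∷ []) (e , _ , nin , _) h2 (dx ∷ _) (nx ∷ _) =
      e , nx , (λ { (here refl) → nin (here refl) ; (there m) → dx m }) , h2
    IPath-++ (x ∷ x' ∷ xs) (e , na , nin , ip) h2 (dx ∷ d) (nx ∷ ne) with AllP.++⁻ xs na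
    ... | na1 , (nay ∷ []) =
      e , AllP.++⁺ na1 (nay ∷ nx) , ∉-mid (x' ∷ xs) nin dx , IPath-++ (x' ∷ xs) ip h2 d ne

    IPath-pair : ∀ {x y} → Edge G x y → IPath (x ∷ y ∷ [])
    IPath-pair e = e , [] , (λ { (here refl) → Edge-irr G e }) , tt

    IPath-snoc : ∀ (xs : List (Fin n)) {l v} → IPath (xs ++ [ l ]) → Edge G l v → v ∉ˡ (xs ++ [ l ]) → NoEdgeTo v xs → IPath (xs ++ l ∷ [ v ])
    IPath-snoc xs ip e nin na =
      IPath-++ xs ip (IPath-pair e) (∉⇒Disjoint-[] (λ m → nin (∈-++⁺ˡ m))) (All-map (λ z → z ∷ []) (NoEdgeTo-flip na)) 

    IPath-reverse-step : ∀ x y (ys : List (Fin n)) → IPath (x ∷ y ∷ ys) → IPath (reverse (y ∷ ys)) → IPath (reverse (x ∷ y ∷ ys))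
    IPath-reverse-step x y ys (e , na , nin , ip) ih =
      subst IPath (sym eq) (IPath-snoc (reverse ys) ih' (Edge-sym G e) nin' (All-tab λ m → All-lookup na (reverse⁻ m)))
      where
      rev≡ : reverse (y ∷ ys) ≡ reverse ys ++ [ y ]
      rev≡ = unfold-reverse y ys
      eq : reverse (x ∷ y ∷ ys) ≡ reverse ys ++ y ∷ [ x ]
      eq = trans (unfold-reverse x (y ∷ ys)) (trans (cong (_++ [ x ]) rev≡) (++-assoc (reverse ys) [ y ] [ x ]))
      ih' : IPath (reverse ys ++ [ y ])
      ih' = subst IPath rev≡ ih
      nin' : x ∉ˡ reverse ys ++ [ y ]
      nin' m with ∈-++⁻ (reverse ys) m
      ... | inj₁ m' = nin (there (reverse⁻ m'))
      ... | inj₂ (here refl) = nin (here refl)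

    IPath-reverse : ∀ (xs : List (Fin n)) → IPath xs → IPath (reverse xs)
    IPath-reverse [] h = tt
    IPath-reverse (x ∷ []) h = tt
    IPath-reverse (x ∷ y ∷ ys) h = IPath-reverse-step x y ys h (IPath-reverse (y ∷ ys) (IPath-tail h))

    OnlyLast-view : ∀ {v q} → OnlyLast v q → ∃ λ q' → ∃ λ l → q ≡ q' ++ [ l ] × NoEdgeTo v q' × Edge G v l
    OnlyLast-view {q = x ∷ []} e = [] , x , refl , [] , e
    OnlyLast-view {q = x ∷ y ∷ ys} (ne , la) with OnlyLast-view {q = y ∷ ys} la
    ... | q' , l , eq , na , e = x ∷ q' , l , cong (x ∷_) eq , ne ∷ na , e

    OnlyLast-snoc : ∀ {v l} (xs : List (Fin n)) → NoEdgeTo v xs → Edge G v l → OnlyLast v (xs ++ [ l ])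
    OnlyLast-snoc [] na e = e
    OnlyLast-snoc (x ∷ []) (nx ∷ []) e = nx , e
    OnlyLast-snoc (x ∷ x' ∷ xs) (nx ∷ na) e = nx , OnlyLast-snoc (x' ∷ xs) na e

    OnlyLast-++⁻ : ∀ {v y ys} (xs : List (Fin n)) → OnlyLast v (xs ++ y ∷ ys) → NoEdgeTo v xs × OnlyLast v (y ∷ ys)
    OnlyLast-++⁻ [] la = [] , la
    OnlyLast-++⁻ (x ∷ []) (nx , la) = nx ∷ [] , la
    OnlyLast-++⁻ (x ∷ x' ∷ xs) (nx , la) with OnlyLast-++⁻ (x' ∷ xs) la
    ... | na , la' = nx ∷ na , la'

    OnlyLast-++ : ∀ {v y ys} (xs : List (Fin n)) → NoEdgeTo v xs → OnlyLast v (y ∷ ys) → OnlyLast v (xs ++ y ∷ ys)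
    OnlyLast-++ [] na la = la
    OnlyLast-++ (x ∷ []) (nx ∷ []) la = nx , la
    OnlyLast-++ (x ∷ x' ∷ xs) (nx ∷ na) la = nx , OnlyLast-++ (x' ∷ xs) na la

    rotate1-closes : ∀ {v a} (q' : List (Fin n)) {l} → IPath (a ∷ q' ++ [ l ]) → Edge G v a → Closes a ((q' ++ [ l ]) ++ [ v ])
    rotate1-closes [] (e , _ , _ , _) ea = e , Edge-sym G ea
    rotate1-closes {v} {a} (b ∷ q₂) {l} (e , na2 , _ , _) ea =
      e , OnlyLast-++ (q₂ ++ [ l ]) na2 (Edge-sym G ea)

    rotate1 : ∀ {v a q} → ICycle v (a ∷ q) → ICycle a (q ++ [ v ])
    rotate1 {v} {a} {q} (ip , nin , ea , la) with OnlyLast-view la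
    ... | q' , l , refl , na , el = ip' , nin' , rotate1-closes q' ip ea
      where
      ipq : IPath (q' ++ [ l ])
      ipq = IPath-tail ip
      ip' : IPath ((q' ++ [ l ]) ++ [ v ])
      ip' = subst IPath (sym (++-assoc q' [ l ] [ v ]))
              (IPath-snoc q' ipq (Edge-sym G el) (λ m → nin (there m)) na)
      nin' : a ∉ˡ (q' ++ [ l ]) ++ [ v ]
      nin' m with ∈-++⁻ (q' ++ [ l ]) m
      ... | inj₁ m' = IPath-head∉ ip m'
      ... | inj₂ (here refl) = nin (here refl)

    rotate : ∀ (xs : List (Fin n)) {v w ys} → ICycle v (xs ++ w ∷ ys) → ICycle w (ys ++ v ∷ xs)
    rotate [] c = rotate1 c
    rotate (x ∷ xs) {v} {w} {ys} c =
      subst (ICycle w) (++-assoc ys [ v ] (x ∷ xs))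
        (rotate xs {x} {w} {ys ++ [ v ]} (subst (ICycle x) (++-assoc xs (w ∷ ys) [ v ]) (rotate1 c)))

module CycleLists where

  open import Defs
  open Basics
  open Paths
  open import Data.Nat using (ℕ; zero; suc; _≤_; s≤s; z≤n; _+_)
  open import Data.Nat.Properties using (suc-injective)
  open import Data.Fin using (Fin; zero; suc; toℕ)
  open import Data.Fin.Properties using (0≢1+n)
  open import Data.List using (List; []; _∷_; length; lookup; tabulate)
  open import Data.List.Relation.Unary.All using (All; []; _∷_) renaming (lookup to All-lookup; tabulate to All-tab)
  import Data.List.Relation.Unary.All.Properties as AllP
  open import Data.List.Relation.Unary.Any using (Any)
  open import Data.List.Membership.Propositional using () renaming (_∈_ to _∈ˡ_; _∉_ to _∉ˡ_)
  open import Data.List.Membership.Propositional.Properties using (∈-lookup; ∈-tabulate⁻)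
  open import Data.Product using (_,_)
  open import Data.Sum using (_⊎_; inj₁; inj₂)
  open import Data.Empty using (⊥-elim)
  open import Data.Unit using (tt)
  open import Function.Bundles using (mk⇔; module Equivalence)
  open Equivalence using (to; from)
  open import Function.Definitions using (Injective)
  open import Relation.Nullary using (¬_)
  open import Relation.Binary.PropositionalEquality using (_≡_; refl; sym; cong; subst)

  PathAdj : ∀ {m} → Fin m → Fin m → Set
  PathAdj i j = toℕ j ≡ suc (toℕ i) ⊎ toℕ i ≡ suc (toℕ j)

  PathAdj-pred : ∀ {m} {i j : Fin m} → PathAdj (suc i) (suc j) → PathAdj i j
  PathAdj-pred (inj₁ e) = inj₁ (suc-injective e)
  PathAdj-pred (inj₂ e) = inj₂ (suc-injective e)

  PathAdj-suc : ∀ {m} {i j : Fin m} → PathAdj i j → PathAdj (suc i) (suc j)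
  PathAdj-suc (inj₁ e) = inj₁ (cong suc e)
  PathAdj-suc (inj₂ e) = inj₂ (cong suc e)

  module _ {n : ℕ} (G : Graph n) where

    IPath-lookup : ∀ (q : List (Fin n)) → IPath G q → ∀ i j → Edge G (lookup q i) (lookup q j) → PathAdj i j
    IPath-lookup (x ∷ []) h zero zero e = ⊥-elim (Edge-irr G e)
    IPath-lookup (x ∷ y ∷ ys) h zero zero e = ⊥-elim (Edge-irr G e)
    IPath-lookup (x ∷ y ∷ ys) h zero (suc zero) e = inj₁ refl
    IPath-lookup (x ∷ y ∷ ys) (_ , na , _ , _) zero (suc (suc j)) e = ⊥-elim (All-lookup na (∈-lookup j) e)
    IPath-lookup (x ∷ y ∷ ys) h (suc zero) zero e = inj₂ refl
    IPath-lookup (x ∷ y ∷ ys) (_ , na , _ , _) (suc (suc i)) zero e = ⊥-elim (All-lookup na (∈-lookup i) (Edge-sym G e))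
    IPath-lookup (x ∷ y ∷ ys) (_ , _ , _ , ip) (suc i) (suc j) e = PathAdj-suc (IPath-lookup (y ∷ ys) ip i j e)

    IPath-lookup⁻ : ∀ (q : List (Fin n)) → IPath G q → ∀ i j → PathAdj i j → Edge G (lookup q i) (lookup q j)
    IPath-lookup⁻ (x ∷ y ∷ ys) (e , _) zero (suc zero) a = e
    IPath-lookup⁻ (x ∷ y ∷ ys) (e , _) (suc zero) zero a = Edge-sym G e
    IPath-lookup⁻ (x ∷ y ∷ ys) (_ , _ , _ , ip) (suc i) (suc j) a = IPath-lookup⁻ (y ∷ ys) ip i j (PathAdj-pred a)
    IPath-lookup⁻ (x ∷ []) h zero zero (inj₁ ())
    IPath-lookup⁻ (x ∷ []) h zero zero (inj₂ ())
    IPath-lookup⁻ (x ∷ y ∷ ys) h zero zero (inj₁ ())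
    IPath-lookup⁻ (x ∷ y ∷ ys) h zero zero (inj₂ ())
    IPath-lookup⁻ (x ∷ y ∷ ys) h zero (suc (suc j)) (inj₁ ())
    IPath-lookup⁻ (x ∷ y ∷ ys) h zero (suc (suc j)) (inj₂ ())
    IPath-lookup⁻ (x ∷ y ∷ ys) h (suc (suc i)) zero (inj₁ ())
    IPath-lookup⁻ (x ∷ y ∷ ys) h (suc (suc i)) zero (inj₂ ())

    IPath-injective : ∀ (q : List (Fin n)) → IPath G q → ∀ i j → lookup q i ≡ lookup q j → i ≡ j
    IPath-injective (x ∷ ys) h zero zero e = refl
    IPath-injective (x ∷ ys) h zero (suc j) e = ⊥-elim (IPath-head∉ G h (subst (_∈ˡ ys) (sym e) (∈-lookup j)))
    IPath-injective (x ∷ ys) h (suc i) zero e = ⊥-elim (IPath-head∉ G h (subst (_∈ˡ ys) e (∈-lookup i)))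
    IPath-injective (x ∷ ys) h (suc i) (suc j) e = cong suc (IPath-injective ys (IPath-tail G h) i j e)

    OnlyLast-lookup : ∀ {v} (q : List (Fin n)) → OnlyLast G v q → ∀ j → Edge G v (lookup q j) → suc (toℕ j) ≡ length q
    OnlyLast-lookup (x ∷ []) la zero e = refl
    OnlyLast-lookup (x ∷ y ∷ ys) (nx , la) zero e = ⊥-elim (nx e)
    OnlyLast-lookup (x ∷ y ∷ ys) (nx , la) (suc j) e = cong suc (OnlyLast-lookup (y ∷ ys) la j e)

    OnlyLast-lookup⁻ : ∀ {v} (q : List (Fin n)) → OnlyLast G v q → ∀ j → suc (toℕ j) ≡ length q → Edge G v (lookup q j)
    OnlyLast-lookup⁻ (x ∷ []) la zero eq = la
    OnlyLast-lookup⁻ (x ∷ y ∷ ys) (nx , la) zero ()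
    OnlyLast-lookup⁻ (x ∷ y ∷ ys) (nx , la) (suc j) eq = OnlyLast-lookup⁻ (y ∷ ys) la j (suc-injective eq)

    OnlyLast-nonempty : ∀ {v} (q : List (Fin n)) → OnlyLast G v q → 1 ≤ length q
    OnlyLast-nonempty (x ∷ q) _ = s≤s z≤n

    Closes-lookup : ∀ {v} p → Closes G v p → ∀ j → Edge G v (lookup p j) → toℕ j ≡ 0 ⊎ suc (toℕ j) ≡ length p
    Closes-lookup (a ∷ q) _ zero e = inj₁ refl
    Closes-lookup (a ∷ q) (_ , la) (suc j) e = inj₂ (cong suc (OnlyLast-lookup q la j e))

    Closes-lookup⁻ : ∀ {v} p → Closes G v p → ∀ j → toℕ j ≡ 0 ⊎ suc (toℕ j) ≡ length p → Edge G v (lookup p j)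
    Closes-lookup⁻ (a ∷ q) (ea , _) zero _ = ea
    Closes-lookup⁻ (a ∷ q) _ (suc j) (inj₁ ())
    Closes-lookup⁻ (a ∷ q) (_ , la) (suc j) (inj₂ eq) = OnlyLast-lookup⁻ q la j (suc-injective eq)

    ICycle-edge⇒adj : ∀ {v p} → ICycle G v p → ∀ (i j : Fin (length (v ∷ p))) →
                      Edge G (lookup (v ∷ p) i) (lookup (v ∷ p) j) → CycAdj G i j
    ICycle-edge⇒adj _ zero zero e = ⊥-elim (Edge-irr G e)
    ICycle-edge⇒adj {p = p} (_ , _ , cl) zero (suc j) e with Closes-lookup p cl j e
    ... | inj₁ eq = inj₁ (cong suc eq)
    ... | inj₂ eq = inj₂ (inj₂ (inj₁ (refl , cong suc eq)))
    ICycle-edge⇒adj {p = p} (_ , _ , cl) (suc i) zero e with Closes-lookup p cl i (Edge-sym G e)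
    ... | inj₁ eq = inj₂ (inj₁ (cong suc eq))
    ... | inj₂ eq = inj₂ (inj₂ (inj₂ (refl , cong suc eq)))
    ICycle-edge⇒adj {p = p} (ip , _ , _) (suc i) (suc j) e with IPath-lookup p ip i j e
    ... | inj₁ eq = inj₁ (cong suc eq)
    ... | inj₂ eq = inj₂ (inj₁ (cong suc eq))

    ICycle-adj⇒edge : ∀ {v p} → ICycle G v p → ∀ (i j : Fin (length (v ∷ p))) →
                      CycAdj G i j → Edge G (lookup (v ∷ p) i) (lookup (v ∷ p) j)
    ICycle-adj⇒edge {p = []} (_ , _ , ()) _ _ _
    ICycle-adj⇒edge _ zero zero (inj₁ ())
    ICycle-adj⇒edge _ zero zero (inj₂ (inj₁ ()))
    ICycle-adj⇒edge {p = _ ∷ _} _ zero zero (inj₂ (inj₂ (inj₁ (_ , ()))))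
    ICycle-adj⇒edge {p = _ ∷ _} _ zero zero (inj₂ (inj₂ (inj₂ (_ , ()))))
    ICycle-adj⇒edge {p = p} (_ , _ , cl) zero (suc j) (inj₁ eq) = Closes-lookup⁻ p cl j (inj₁ (suc-injective eq))
    ICycle-adj⇒edge _ zero (suc j) (inj₂ (inj₁ ()))
    ICycle-adj⇒edge {p = p} (_ , _ , cl) zero (suc j) (inj₂ (inj₂ (inj₁ (_ , eq)))) = Closes-lookup⁻ p cl j (inj₂ (suc-injective eq))
    ICycle-adj⇒edge _ zero (suc j) (inj₂ (inj₂ (inj₂ (() , _))))
    ICycle-adj⇒edge _ (suc i) zero (inj₁ ())
    ICycle-adj⇒edge {p = p} (_ , _ , cl) (suc i) zero (inj₂ (inj₁ eq)) = Edge-sym G (Closes-lookup⁻ p cl i (inj₁ (suc-injective eq)))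
    ICycle-adj⇒edge _ (suc i) zero (inj₂ (inj₂ (inj₁ (() , _))))
    ICycle-adj⇒edge {p = p} (_ , _ , cl) (suc i) zero (inj₂ (inj₂ (inj₂ (_ , eq)))) = Edge-sym G (Closes-lookup⁻ p cl i (inj₂ (suc-injective eq)))
    ICycle-adj⇒edge {p = p} (ip , _ , _) (suc i) (suc j) (inj₁ eq) = IPath-lookup⁻ p ip i j (inj₁ (suc-injective eq))
    ICycle-adj⇒edge {p = p} (ip , _ , _) (suc i) (suc j) (inj₂ (inj₁ eq)) = IPath-lookup⁻ p ip i j (inj₂ (suc-injective eq))
    ICycle-adj⇒edge _ (suc i) (suc j) (inj₂ (inj₂ (inj₁ (() , _))))
    ICycle-adj⇒edge _ (suc i) (suc j) (inj₂ (inj₂ (inj₂ (() , _))))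

    ICycle⇒induced : ∀ {v p} → ICycle G v p → IsInducedCycle G (length (v ∷ p)) (lookup (v ∷ p))
    ICycle⇒induced {v} {a ∷ q} c@(ip , nin , _ , la) =
      s≤s (s≤s (OnlyLast-nonempty q la)) , inj ,
      λ i j → mk⇔ (ICycle-edge⇒adj c i j) (ICycle-adj⇒edge c i j)
      where
      inj : Injective _≡_ _≡_ (lookup (v ∷ a ∷ q))
      inj {zero} {zero} e = refl
      inj {zero} {suc j} e = ⊥-elim (nin (subst (_∈ˡ a ∷ q) (sym e) (∈-lookup j)))
      inj {suc i} {zero} e = ⊥-elim (nin (subst (_∈ˡ a ∷ q) e (∈-lookup i)))
      inj {suc i} {suc j} e = cong suc (IPath-injective (a ∷ q) ip i j e)

    induced⇒cycle : ∀ {ℓ f} → IsInducedCycle G ℓ f → IsCycle G ℓ f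
    induced⇒cycle (l3 , inj , adj) = l3 , inj , λ i j c → from (adj i j) c

    ICycle-length : ∀ {k v p} → SC G k → ICycle G v p → suc (length p) ≡ k
    ICycle-length (inj₁ nc) c = ⊥-elim (nc (_ , _ , induced⇒cycle (ICycle⇒induced c)))
    ICycle-length (inj₂ all) c = all _ _ (ICycle⇒induced c)

    IPath-tabulate : ∀ m (g : Fin m → Fin n) → Injective _≡_ _≡_ g →
             (∀ i j → Edge G (g i) (g j) → PathAdj i j) → (∀ i j → PathAdj i j → Edge G (g i) (g j)) →
             IPath G (tabulate g)
    IPath-tabulate zero g inj a b = tt
    IPath-tabulate (suc zero) g inj a b = tt
    IPath-tabulate (suc (suc m)) g inj a b =
      b zero (suc zero) (inj₁ refl) ,
      AllP.tabulate⁺ (λ i e → nadj (a zero (suc (suc i)) e)) ,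
      (λ mem → nmem mem) ,
      IPath-tabulate (suc m) (λ i → g (suc i)) (λ e → suc-inj (inj e))
        (λ i j e → PathAdj-pred (a (suc i) (suc j) e)) (λ i j ad → b (suc i) (suc j) (PathAdj-suc ad))
      where
      nadj : ∀ {i : Fin m} → ¬ PathAdj {suc (suc m)} zero (suc (suc i))
      nadj (inj₁ ())
      nadj (inj₂ ())
      suc-inj : ∀ {i j : Fin (suc m)} → _≡_ {A = Fin (suc (suc m))} (suc i) (suc j) → i ≡ j
      suc-inj refl = refl
      nmem : g zero ∉ˡ tabulate (λ i → g (suc i))
      nmem mem with ∈-tabulate⁻ mem
      ... | i , e = 0≢1+n (inj {zero} {suc i} e)

    OnlyLast-tabulate : ∀ {v} m (g : Fin (suc m) → Fin n) → (∀ j → Edge G v (g j) → suc (toℕ j) ≡ suc m) →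
                (∀ j → suc (toℕ j) ≡ suc m → Edge G v (g j)) → OnlyLast G v (tabulate g)
    OnlyLast-tabulate zero g a b = b zero refl
    OnlyLast-tabulate (suc m) g a b = (λ e → 1≢2+m (a zero e)) ,
      OnlyLast-tabulate m (λ j → g (suc j)) (λ j e → suc-injective (a (suc j) e)) (λ j eq → b (suc j) (cong suc eq))
      where
      1≢2+m : ¬ (1 ≡ suc (suc m))
      1≢2+m ()

    induced⇒ICycle : ∀ {ℓ} {f : Fin (suc ℓ) → Fin n} → IsInducedCycle G (suc ℓ) f →
               ICycle G (f zero) (tabulate (λ i → f (suc i)))
    induced⇒ICycle {zero} (s≤s () , _)
    induced⇒ICycle {suc zero} (s≤s (s≤s ()) , _)
    induced⇒ICycle {suc (suc ℓ)} {f} (l3 , inj , adj) = ip , nin , ends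
      where
      ip : IPath G (tabulate (λ i → f (suc i)))
      ip = IPath-tabulate (suc (suc ℓ)) (λ i → f (suc i)) (λ e → sinj (inj e)) fw bw
        where
        sinj : ∀ {i j : Fin (suc (suc ℓ))} → _≡_ {A = Fin (suc (suc (suc ℓ)))} (suc i) (suc j) → i ≡ j
        sinj refl = refl
        fw : ∀ i j → Edge G (f (suc i)) (f (suc j)) → PathAdj i j
        fw i j e with to (adj (suc i) (suc j)) e
        ... | inj₁ x = inj₁ (suc-injective x)
        ... | inj₂ (inj₁ x) = inj₂ (suc-injective x)
        ... | inj₂ (inj₂ (inj₁ (() , _)))
        ... | inj₂ (inj₂ (inj₂ (() , _)))
        bw : ∀ i j → PathAdj i j → Edge G (f (suc i)) (f (suc j))
        bw i j (inj₁ x) = from (adj (suc i) (suc j)) (inj₁ (cong suc x))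
        bw i j (inj₂ x) = from (adj (suc i) (suc j)) (inj₂ (inj₁ (cong suc x)))
      nin : f zero ∉ˡ tabulate (λ i → f (suc i))
      nin mem with ∈-tabulate⁻ mem
      ... | i , e = 0≢1+n (inj {zero} {suc i} e)
      ends : Closes G (f zero) (tabulate (λ i → f (suc i)))
      ends = from (adj zero (suc zero)) (inj₁ refl) ,
             OnlyLast-tabulate ℓ (λ j → f (suc (suc j))) fw bw
        where
        fw : ∀ j → Edge G (f zero) (f (suc (suc j))) → suc (toℕ j) ≡ suc ℓ
        fw j e with to (adj zero (suc (suc j))) e
        ... | inj₁ ()
        ... | inj₂ (inj₁ ())
        ... | inj₂ (inj₂ (inj₁ (_ , eq))) = suc-injective (suc-injective eq)
        ... | inj₂ (inj₂ (inj₂ (() , _)))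
        bw : ∀ j → suc (toℕ j) ≡ suc ℓ → Edge G (f zero) (f (suc (suc j)))
        bw j eq = from (adj zero (suc (suc j))) (inj₂ (inj₂ (inj₁ (refl , cong suc (cong suc eq)))))

-- An ear of an induced
-- cycle C is an induced path a, x₁, …, x_r, b whose ends a, b are non-adjacent vertices of C
-- and whose inner vertices avoid C.
-- Write C = a, L1, b, L2.  By induction on r:
--  * an inner vertex other than x_r seeing a vertex z of C with z ≁ a yields a shorter ear
--    from a to z ('earlyChord⊥'), and symmetrically for b ('lateChord⊥');
--  * hence the inner vertices see no vertex of L2, so that a, x₁ … x_r, b, L2 is an induced
--    cycle, or L2 is a single common neighbour of a and b ('L2-free-or-single'), and the same
--    holds for L1;
--  * every combination makes k even or 3 ('arcLengths⊥'); r = 1 is treated by a separate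
--    induction on |L1| ('oneInner⊥').
module Ears where

  open import Defs
  open Basics
  open Paths
  open CycleLists
  open import Data.Nat using (ℕ; suc; _≤_; _<_; s≤s; z≤n; _+_)
  open import Data.Nat.Properties using (suc-injective; +-suc; +-comm; +-cancelˡ-≡; +-cancelʳ-≡; ≤-trans; ≤-refl; m≤m+n; <⇒≢)
  open import Data.Fin using (Fin)
  open import Data.List using (List; []; _∷_; _++_; reverse; length; [_])
  open import Data.List.Properties using (++-assoc; unfold-reverse; length-++; length-reverse; reverse-++)
  open import Data.List.Relation.Unary.All using (All; []; _∷_) renaming (lookup to All-lookup; tabulate to All-tab; map to All-map)
  import Data.List.Relation.Unary.All.Properties as AllP
  open import Data.List.Relation.Unary.All.Properties.Core using (¬Any⇒All¬)
  open import Data.List.Relation.Unary.Any using (here; there; any?)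
  import Data.List.Relation.Unary.Any as Any
  open import Data.List.Relation.Unary.Any.Properties using (reverse⁺; reverse⁻)
  open import Data.List.Membership.Propositional using (find) renaming (_∈_ to _∈ˡ_; _∉_ to _∉ˡ_)
  open import Data.List.Membership.Propositional.Properties using (∈-++⁺ˡ; ∈-++⁺ʳ; ∈-++⁻; ∈-∃++)
  open import Data.Product using (Σ; ∃; _,_; proj₁; proj₂)
  open import Data.Sum using (_⊎_; inj₁; inj₂)
  open import Data.Empty using (⊥; ⊥-elim)
  open import Data.Unit using (tt)
  open import Relation.Nullary using (¬_; yes; no)
  open import Relation.Binary.PropositionalEquality using (_≡_; _≢_; refl; sym; trans; cong; subst)

  length-++-∷ : ∀ {A : Set} (xs : List A) {y ys} → length (xs ++ y ∷ ys) ≡ length xs + suc (length ys)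
  length-++-∷ xs {y} {ys} = length-++ xs {y ∷ ys}

  length≡1 : ∀ {A : Set} (xs : List A) → length xs ≡ 1 → ∃ λ z → xs ≡ [ z ]
  length≡1 (z ∷ []) refl = z , refl

  module NoEar {n : ℕ} (G : Graph n) (k : ℕ) (sc : SC G k) (k≢3 : k ≢ 3) (k-odd : ∀ q → q + q ≢ k) where

    noTriangle : ∀ {x y z} → Edge G x y → Edge G y z → Edge G x z → ⊥
    noTriangle {x} {y} {z} e1 e2 e3 = k≢3 (sym (ICycle-length G sc triangle))
      where
      triangle : ICycle G x (y ∷ z ∷ [])
      triangle = IPath-pair G e2 , (λ { (here refl) → Edge-irr G e1 ; (there (here refl)) → Edge-irr G e3 }) , e1 , e3

    -- The cycle has length suc (l1 + suc l2) = k, where l1, l2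
    -- are the lengths of its arcs; an ear with r inner vertices closes, with an arc, a cycle
    -- of length suc (r + suc lᵢ), unless that arc is a single vertex.
    cancelʳ-k : ∀ r l m → suc (r + m) ≡ k → suc (l + m) ≡ k → r ≡ l
    cancelʳ-k r l m e1 e2 = +-cancelʳ-≡ m r l (suc-injective (trans e1 (sym e2)))

    cancelˡ-k : ∀ l r s → suc (l + r) ≡ k → suc (l + s) ≡ k → r ≡ s
    cancelˡ-k l r s e1 e2 = +-cancelˡ-≡ l r s (suc-injective (trans e1 (sym e2)))

    arcLengths⊥ : ∀ r l1 l2 → 2 ≤ r → suc (l1 + suc l2) ≡ k →
                  (suc (r + suc l2) ≡ k ⊎ l2 ≡ 1) → (suc (r + suc l1) ≡ k ⊎ l1 ≡ 1) → ⊥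
    arcLengths⊥ r l1 l2 2≤r e0 (inj₁ a2) (inj₁ a1) =
      k-odd (suc l1) (subst (λ q → suc (q + suc l1) ≡ k) (cancelʳ-k r l1 (suc l2) a2 e0) a1)
    arcLengths⊥ r l1 l2 2≤r e0 (inj₂ refl) (inj₁ a1) =
      <⇒≢ 2≤r (sym (cancelʳ-k r 1 (suc l1) a1 (trans (cong suc (+-comm 2 l1)) e0)))
    arcLengths⊥ r l1 l2 2≤r e0 (inj₁ a2) (inj₂ refl) = <⇒≢ 2≤r (sym (cancelʳ-k r 1 (suc l2) a2 e0))
    arcLengths⊥ r l1 l2 2≤r e0 (inj₂ refl) (inj₂ refl) = k-odd 2 e0

    record Ear : Set where
      field
        a b : Fin n
        L1 L2 xs : List (Fin n)
        cyc : ICycle G a (L1 ++ b ∷ L2)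
        nab : ¬ Edge G a b
        path : IPath G (a ∷ xs ++ [ b ])
        disj : Disjoint G xs (L1 ++ b ∷ L2)

    open Ear

    a∉xs : (c : Ear) → a c ∉ˡ xs c
    a∉xs c m = IPath-head∉ G (path c) (∈-++⁺ˡ m)

    a≢b : (c : Ear) → a c ≢ b c
    a≢b c refl = IPath-head∉ G (path c) (∈-++⁺ʳ (xs c) (here refl))

    a∉cyc : (c : Ear) → a c ∉ˡ (L1 c ++ b c ∷ L2 c)
    a∉cyc c = proj₁ (proj₂ (cyc c))

    xs∉cyc : (c : Ear) → ∀ {x} → x ∈ˡ xs c → x ∉ˡ (L1 c ++ b c ∷ L2 c)
    xs∉cyc c m = All-lookup (disj c) m

    OnlyLast-bL2 : (c : Ear) → OnlyLast G (a c) (b c ∷ L2 c)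
    OnlyLast-bL2 c with L1 c | cyc c | nab c
    ... | [] | (_ , _ , e , _) | nb = ⊥-elim (nb e)
    ... | l ∷ L1' | (_ , _ , _ , la) | _ = proj₂ (OnlyLast-++⁻ G L1' la)

    IPath-bL2 : (c : Ear) → IPath G (b c ∷ L2 c)
    IPath-bL2 c = proj₂ (IPath-++⁻ G (L1 c) (proj₁ (cyc c)))

    path-at : (c : Ear) → ∀ {q} → xs c ≡ q → IPath G (a c ∷ q ++ [ b c ])
    path-at c eq = subst (λ q → IPath G (a c ∷ q ++ [ b c ])) eq (path c)

    cycle-length : (c : Ear) → suc (length (L1 c) + suc (length (L2 c))) ≡ k
    cycle-length c = trans (cong suc (sym (length-++-∷ (L1 c)))) (ICycle-length G sc (cyc c))

    earCycle : (c : Ear) → NoEdges G (xs c) (L2 c) → ICycle G (a c) (xs c ++ b c ∷ L2 c)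
    earCycle c noe with xs c | path c | disj c | a∉xs c
    ... | [] | (e , _) | _ | _ = ⊥-elim (nab c e)
    ... | x₁ ∷ xs' | (e , na , nin , ip) | dj | ax =
      IPath-++ G (x₁ ∷ xs') ip (IPath-bL2 c) dj' noe , nin' , e ,
      OnlyLast-++ G xs' (AllP.++⁻ˡ xs' na) (OnlyLast-bL2 c)
      where
      dj' : Disjoint G (x₁ ∷ xs') (L2 c)
      dj' = All-tab λ m m2 → All-lookup dj m (∈-++⁺ʳ (L1 c) (there m2))
      nin' : a c ∉ˡ (x₁ ∷ xs') ++ b c ∷ L2 c
      nin' m with ∈-++⁻ (x₁ ∷ xs') m
      ... | inj₁ m' = ax m'
      ... | inj₂ (here eq) = a≢b c eq
      ... | inj₂ (there m') = a∉cyc c (∈-++⁺ʳ (L1 c) (there m'))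

    earCycle-length : (c : Ear) → NoEdges G (xs c) (L2 c) → suc (length (xs c) + suc (length (L2 c))) ≡ k
    earCycle-length c noe = trans (cong suc (sym (length-++-∷ (xs c)))) (ICycle-length G sc (earCycle c noe))

    swap : Ear → Ear
    swap c = record
      { a = b c ; b = a c ; L1 = L2 c ; L2 = L1 c ; xs = reverse (xs c)
      ; cyc = rotate G (L1 c) (cyc c)
      ; nab = λ e → nab c (Edge-sym G e)
      ; path = subst (IPath G) reversed (IPath-reverse G (a c ∷ xs c ++ [ b c ]) (path c))
      ; disj = All-tab λ {x} m → avoids (reverse⁻ m)
      }
      where
      reversed : reverse (a c ∷ xs c ++ [ b c ]) ≡ b c ∷ reverse (xs c) ++ [ a c ]
      reversed = trans (unfold-reverse (a c) (xs c ++ [ b c ])) (cong (_++ [ a c ]) (reverse-++ (xs c) [ b c ]))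
      avoids : ∀ {x} → x ∈ˡ xs c → x ∉ˡ L2 c ++ a c ∷ L1 c
      avoids m m2 with ∈-++⁻ (L2 c) m2
      ... | inj₁ m3 = xs∉cyc c m (∈-++⁺ʳ (L1 c) (there m3))
      ... | inj₂ (here refl) = a∉xs c m
      ... | inj₂ (there m3) = xs∉cyc c m (∈-++⁺ˡ m3)

    swap-length : (c : Ear) → length (xs (swap c)) ≡ length (xs c)
    swap-length c = length-reverse (xs c)

    L2-single : (c : Ear) → ∀ {z} → z ∈ˡ L2 c → Edge G (a c) z → Edge G (b c) z → L2 c ≡ [ z ]
    L2-single c {z} m ea eb with L2 c | IPath-bL2 c | OnlyLast-bL2 c | m
    ... | h ∷ [] | _ | _ | here refl = refl
    ... | h ∷ [] | _ | _ | there ()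
    ... | h ∷ h' ∷ T | _ | (_ , na' , _) | here refl = ⊥-elim (na' ea)
    ... | h ∷ h' ∷ T | (_ , na , _) | _ | there m' = ⊥-elim (All-lookup na m' eb)

    shortcut : (c : Ear) → ∀ {z} ws y zs → xs c ≡ ws ++ y ∷ zs → z ∈ˡ (L1 c ++ b c ∷ L2 c) →
               ¬ Edge G (a c) z → Edge G y z → NoEdgeTo G z ws →
               Σ Ear (λ c' → length (xs c') ≡ length (ws ++ [ y ]))
    shortcut c {z} ws y zs eq mz naz eyz naw with ∈-∃++ mz
    ... | U1 , U2 , eqU = c' , refl
      where
      regroup : a c ∷ (ws ++ y ∷ zs) ++ [ b c ] ≡ (a c ∷ ws ++ [ y ]) ++ zs ++ [ b c ]
      regroup = cong (a c ∷_) (trans (++-assoc ws (y ∷ zs) [ b c ]) (sym (++-assoc ws [ y ] (zs ++ [ b c ]))))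
      prefix : IPath G (a c ∷ ws ++ [ y ])
      prefix = proj₁ (IPath-++⁻ G (a c ∷ ws ++ [ y ]) (subst (IPath G) regroup (path-at c eq)))
      inxs : ∀ {w} → w ∈ˡ ws ++ [ y ] → w ∈ˡ xs c
      inxs {w} m with ∈-++⁻ ws m
      ... | inj₁ m' = subst (w ∈ˡ_) (sym eq) (∈-++⁺ˡ m')
      ... | inj₂ (here refl) = subst (w ∈ˡ_) (sym eq) (∈-++⁺ʳ ws (here refl))
      znin : z ∉ˡ (a c ∷ ws) ++ [ y ]
      znin (here refl) = a∉cyc c mz
      znin (there m) = xs∉cyc c (inxs m) mz
      extended : IPath G ((a c ∷ ws) ++ y ∷ [ z ])
      extended = IPath-snoc G (a c ∷ ws) prefix eyz znin ((λ e → naz (Edge-sym G e)) ∷ naw)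
      c' : Ear
      c' = record
        { a = a c ; b = z ; L1 = U1 ; L2 = U2 ; xs = ws ++ [ y ]
        ; cyc = subst (ICycle G (a c)) eqU (cyc c)
        ; nab = naz
        ; path = subst (λ q → IPath G (a c ∷ q)) (sym (++-assoc ws [ y ] [ z ])) extended
        ; disj = All-tab λ m m2 → xs∉cyc c (inxs m) (subst (_ ∈ˡ_) (sym eqU) m2)
        }

    Shortest : Ear → Set
    Shortest c = ∀ c' → length (xs c') < length (xs c) → ⊥

    earlyChord⊥ : (c : Ear) → Shortest c → ∀ {z y} I l → xs c ≡ I ++ [ l ] → y ∈ˡ I →
                  z ∈ˡ (L1 c ++ b c ∷ L2 c) → ¬ Edge G (a c) z → Edge G y z → ⊥
    earlyChord⊥ c shortest {z} {y} I l eq my mz naz eyz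
      with first (λ w → Edge? G w z) I (Any.map (λ { refl → eyz }) my)
    ... | ws , y' , zs , refl , ey' , naw
      with shortcut c ws y' (zs ++ [ l ]) (trans eq (++-assoc ws (y' ∷ zs) [ l ])) mz naz ey' (NoEdgeTo-unflip G naw)
    ...   | c' , leq = shortest c' (subst (_< length (xs c)) (sym leq) shorter)
      where
      shorter : length (ws ++ [ y' ]) < length (xs c)
      shorter rewrite eq | length-++ ws {[ y' ]} | length-++ (ws ++ y' ∷ zs) {[ l ]} | length-++ ws {y' ∷ zs} =
        prefix<whole (length ws) (length zs)
        where
        prefix<whole : ∀ p q → p + 1 < (p + suc q) + 1
        prefix<whole p q rewrite +-comm p 1 | +-comm (p + suc q) 1 | +-suc p q = s≤s (s≤s (m≤m+n p q))

    lateChord⊥ : (c : Ear) → Shortest c → ∀ {z y} x₁ T → xs c ≡ x₁ ∷ T → y ∈ˡ T →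
                 z ∈ˡ (L2 c ++ a c ∷ L1 c) → ¬ Edge G (b c) z → Edge G y z → ⊥
    lateChord⊥ c shortest x₁ T eq my mz nbz eyz =
      earlyChord⊥ (swap c) (λ c' lt → shortest c' (subst (length (xs c') <_) (swap-length c) lt)) (reverse T) x₁
        (trans (cong reverse eq) (unfold-reverse x₁ T)) (reverse⁺ my) mz nbz eyz

    lastEdge : ∀ {x} I l {y} → IPath G (x ∷ I ++ l ∷ [ y ]) → Edge G l y
    lastEdge {x} I l {y} ip with IPath-++⁻ G (x ∷ I) ip
    ... | _ , (e , _) = e

    -- For a shortest ear with r ≥ 2 inner vertices x₁ … l: an edge from x to z ∈ L2 forces
    -- z ~ a and z ~ b (otherwise a chord, or a triangle a x₁ z or l b z), so L2 = [z].
    L2-free-or-single : (c : Ear) → Shortest c → ∀ x₁ I' l → xs c ≡ x₁ ∷ I' ++ [ l ] →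
                        NoEdges G (xs c) (L2 c) ⊎ ∃ λ z → L2 c ≡ [ z ]
    L2-free-or-single c shortest x₁ I' l eq with any? (λ x → any? (λ z → Edge? G x z) (L2 c)) (xs c)
    ... | no none = inj₁ (All-map (λ h → ¬Any⇒All¬ (L2 c) h) (¬Any⇒All¬ (xs c) none))
    ... | yes some with find some
    ...   | x , mx , seesL2 with find seesL2
    ...     | z , mz , exz = classify (Edge? G (a c) z) (Edge? G (b c) z)
      where
      zc : z ∈ˡ (L1 c ++ b c ∷ L2 c)
      zc = ∈-++⁺ʳ (L1 c) (there mz)
      zc' : z ∈ˡ (L2 c ++ a c ∷ L1 c)
      zc' = ∈-++⁺ˡ mz
      pth : IPath G (a c ∷ (x₁ ∷ I' ++ [ l ]) ++ [ b c ])
      pth = path-at c eq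
      elb : Edge G l (b c)
      elb = lastEdge (x₁ ∷ I') l (subst (λ q → IPath G (a c ∷ q)) (++-assoc (x₁ ∷ I') [ l ] [ b c ]) pth)
      eax : Edge G (a c) x₁
      eax = proj₁ pth
      mx' : x ∈ˡ x₁ ∷ I' ++ [ l ]
      mx' = subst (x ∈ˡ_) eq mx
      classify : _ → _ → NoEdges G (xs c) (L2 c) ⊎ ∃ λ z → L2 c ≡ [ z ]
      classify (yes eaz) (yes ebz) = inj₂ (z , L2-single c mz eaz ebz)
      classify (yes eaz) (no nbz) with mx'
      ... | here refl = ⊥-elim (noTriangle eax exz eaz)
      ... | there m = ⊥-elim (lateChord⊥ c shortest x₁ (I' ++ [ l ]) eq m zc' nbz exz)
      classify (no naz) eb with ∈-++⁻ (x₁ ∷ I') mx'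
      ... | inj₁ m = ⊥-elim (earlyChord⊥ c shortest (x₁ ∷ I') l eq m zc naz exz)
      ... | inj₂ (here refl) with eb
      ...   | yes ebz = ⊥-elim (noTriangle elb ebz exz)
      ...   | no nbz = ⊥-elim (lateChord⊥ c shortest x₁ (I' ++ [ l ]) eq (∈-++⁺ʳ I' (here refl)) zc' nbz exz)

    -- One inner vertex x seeing no vertex of L1: then b, x, a, L1 is an induced cycle, which
    -- forces |L2| = 1, and with L2 = [z] the vertices a, x, b, z form a triangle or a 4-cycle.
    blindInner⊥ : (c : Ear) → ∀ x → xs c ≡ [ x ] → Edge G (a c) x → NoEdgeTo G x (L1 c) → ⊥
    blindInner⊥ c x eq eax blind = fourCycle (length≡1 (L2 c) l2≡1)
      where
      l1 = length (L1 c)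
      xs≡[x] : xs (swap c) ≡ [ x ]
      xs≡[x] = cong reverse eq
      backCycle : suc (1 + suc l1) ≡ k
      backCycle = subst (λ q → suc (length q + suc l1) ≡ k) xs≡[x]
        (earCycle-length (swap c) (subst (λ q → NoEdges G q (L1 c)) (sym xs≡[x]) (blind ∷ [])))
      l2≡1 : length (L2 c) ≡ 1
      l2≡1 = suc-injective (cancelˡ-k l1 (suc (length (L2 c))) 2 (cycle-length c) (trans (cong suc (+-comm l1 2)) backCycle))
      fourCycle : (∃ λ z → L2 c ≡ [ z ]) → ⊥
      fourCycle (z , eqz) with Edge? G x z
      ... | yes exz = noTriangle eax exz (proj₂ (subst (λ q → OnlyLast G (a c) (b c ∷ q)) eqz (OnlyLast-bL2 c)))
      ... | no nxz = k-odd 2 (subst (λ q → suc (length q + 2) ≡ k) eq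
                       (subst (λ q → suc (length (xs c) + suc (length q)) ≡ k) eqz (earCycle-length c noEdges)))
        where
        noEdges : NoEdges G (xs c) (L2 c)
        noEdges rewrite eq | eqz = (nxz ∷ []) ∷ []

    -- An ear with one inner vertex x.  If x sees L1, its first neighbour z there gives an ear
    -- a, x, z with a shorter first arc (z ~ a would be a triangle); otherwise use blindInner⊥.
    oneInner⊥ : ∀ bound (c : Ear) x → xs c ≡ [ x ] → length (L1 c) < bound → ⊥
    oneInner⊥ (suc bound) c x eq (s≤s lt) with path-at c eq
    ... | (eax , _ , _ , exb , _) with any? (Edge? G x) (L1 c)
    ...   | yes seesL1 with first (Edge? G x) (L1 c) seesL1
    ...     | U1 , z , U2 , eqL , exz , _ with Edge? G (a c) z
    ...       | yes eaz = noTriangle eax exz eaz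
    ...       | no naz = oneInner⊥ bound c' x refl shorter
      where
      eqc : L1 c ++ b c ∷ L2 c ≡ U1 ++ z ∷ (U2 ++ b c ∷ L2 c)
      eqc = trans (cong (_++ b c ∷ L2 c) eqL) (++-assoc U1 (z ∷ U2) (b c ∷ L2 c))
      zc : z ∈ˡ L1 c ++ b c ∷ L2 c
      zc = subst (z ∈ˡ_) (sym eqc) (∈-++⁺ʳ U1 (here refl))
      xm : x ∈ˡ xs c
      xm = subst (x ∈ˡ_) (sym eq) (here refl)
      c' : Ear
      c' = record
        { a = a c ; b = z ; L1 = U1 ; L2 = U2 ++ b c ∷ L2 c ; xs = [ x ]
        ; cyc = subst (ICycle G (a c)) eqc (cyc c)
        ; nab = naz
        ; path = eax , (naz ∷ []) ,
                 (λ { (here refl) → a∉xs c xm ; (there (here refl)) → a∉cyc c zc }) ,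
                 exz , [] , (λ { (here refl) → xs∉cyc c xm zc }) , tt
        ; disj = (λ m → xs∉cyc c xm (subst (x ∈ˡ_) (sym eqc) m)) ∷ []
        }
      shorter : length U1 < bound
      shorter = ≤-trans U1<L1 (subst (_≤ bound) (cong length eqL) lt)
        where
        U1<L1 : suc (length U1) ≤ length (U1 ++ z ∷ U2)
        U1<L1 rewrite length-++-∷ U1 {z} {U2} | +-suc (length U1) (length U2) = s≤s (m≤m+n (length U1) (length U2))
    oneInner⊥ (suc bound) c x eq (s≤s lt) | (eax , _ , _ , exb , _) | no blind =
      blindInner⊥ c x eq eax (¬Any⇒All¬ (L1 c) blind)

    noEar-bounded : ∀ bound (c : Ear) → length (xs c) < bound → ⊥
    noEar-bounded (suc bound) c (s≤s lt) with xs c in eq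
    ... | [] = nab c (proj₁ (path-at c eq))
    ... | x ∷ [] = oneInner⊥ (suc (length (L1 c))) c x eq ≤-refl
    ... | x₁ ∷ x₂ ∷ T with snocView x₂ T
    ...   | I , l , eqs =
            arcLengths⊥ (length (xs c)) (length (L1 c)) (length (L2 c)) 2≤r (cycle-length c)
              (arc (L2-free-or-single c shortest x₁ I l eq'))
              (arcˢ (L2-free-or-single (swap c) shortest' l (reverse I) x₁ eqˢ))
      where
      shortest : Shortest c
      shortest c' lt' = noEar-bounded bound c' (≤-trans lt' (subst (λ q → length q ≤ bound) (sym eq) lt))
      shortest' : Shortest (swap c)
      shortest' c' lt' = shortest c' (subst (length (xs c') <_) (swap-length c) lt')
      eq' : xs c ≡ x₁ ∷ I ++ [ l ]
      eq' = trans eq (cong (x₁ ∷_) eqs)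
      eqˢ : xs (swap c) ≡ l ∷ reverse I ++ [ x₁ ]
      eqˢ = trans (cong reverse eq') (trans (reverse-++ (x₁ ∷ I) [ l ]) (cong (l ∷_) (unfold-reverse x₁ I)))
      2≤r : 2 ≤ length (xs c)
      2≤r rewrite eq = s≤s (s≤s z≤n)
      arc : NoEdges G (xs c) (L2 c) ⊎ (∃ λ z → L2 c ≡ [ z ]) →
            suc (length (xs c) + suc (length (L2 c))) ≡ k ⊎ length (L2 c) ≡ 1
      arc (inj₁ free) = inj₁ (earCycle-length c free)
      arc (inj₂ (z , refl)) = inj₂ refl
      arcˢ : NoEdges G (xs (swap c)) (L1 c) ⊎ (∃ λ z → L1 c ≡ [ z ]) →
             suc (length (xs c) + suc (length (L1 c))) ≡ k ⊎ length (L1 c) ≡ 1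
      arcˢ (inj₁ free) = inj₁ (subst (λ q → suc (q + suc (length (L1 c))) ≡ k) (swap-length c) (earCycle-length (swap c) free))
      arcˢ (inj₂ (z , refl)) = inj₂ refl

    noEar : Ear → ⊥
    noEar c = noEar-bounded (suc (length (xs c))) c ≤-refl

module Extraction where

  open import Defs
  open Basics
  open Paths
  open CycleLists
  open import Data.Nat using (ℕ; zero; suc)
  open import Data.Fin using (Fin; zero; suc; _≟_)
  open import Data.Fin.Subset using (Subset; _∈_; _∉_; _─_; ⊤; outside)
  open import Data.Fin.Subset.Properties using (_∈?_; x∈p∧x∉q⇒x∈p─q)
  open import Data.Vec using (Vec; []; _∷_)
  import Data.Vec as Vec
  import Data.Vec.Base as VB
  open import Data.Bool using (Bool)
  open import Data.List using (List; []; _∷_; _++_; [_])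
  open import Data.List.Properties using (++-assoc)
  open import Data.List.Relation.Unary.All using (All; []; _∷_) renaming (lookup to All-lookup; tabulate to All-tab; map to All-map)
  import Data.List.Relation.Unary.All.Properties as AllP
  open import Data.List.Relation.Unary.All.Properties.Core using (¬Any⇒All¬)
  open import Data.List.Relation.Unary.Any using (Any; here; there; any?)
  import Data.List.Relation.Unary.Any as Any
  open import Data.List.Membership.Propositional using () renaming (_∈_ to _∈ˡ_; _∉_ to _∉ˡ_)
  open import Data.List.Membership.Propositional.Properties using (∈-++⁺ˡ; ∈-++⁺ʳ; ∈-++⁻; ∈-∃++)
  open import Data.Product using (∃; _×_; _,_; proj₁; proj₂)
  open import Data.Sum using (_⊎_; inj₁; inj₂)
  open import Data.Empty using (⊥-elim)
  open import Data.Unit using (⊤; tt)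
  open import Relation.Nullary using (¬_; Dec; yes; no; _⊎-dec_)
  open import Relation.Unary using (Decidable)
  open import Relation.Binary.PropositionalEquality using (_≡_; _≢_; refl; sym; trans; cong; subst)

  _∈ˡ?_ : ∀ {n} (x : Fin n) (xs : List (Fin n)) → Dec (x ∈ˡ xs)
  x ∈ˡ? xs = any? (x ≟_) xs

  fromList : ∀ {n} → List (Fin n) → Subset n
  fromList xs = subsetOf (_∈ˡ? xs)

  fromList⁺ : ∀ {n} {x : Fin n} {xs} → x ∈ˡ xs → x ∈ fromList xs
  fromList⁺ {xs = xs} = subsetOf⁺ (_∈ˡ? xs)

  fromList⁻ : ∀ {n} {x : Fin n} {xs} → x ∈ fromList xs → x ∈ˡ xs
  fromList⁻ {xs = xs} = subsetOf⁻ (_∈ˡ? xs)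

  lastOf : ∀ {A : Set} → A → List A → A
  lastOf x [] = x
  lastOf x (y ∷ ys) = lastOf y ys

  lastOf-++ : ∀ {A : Set} {x c : A} A' B → lastOf x (A' ++ c ∷ B) ≡ lastOf c B
  lastOf-++ [] B = refl
  lastOf-++ (y ∷ A') B = lastOf-++ A' B

  lastOf-snoc : ∀ {A : Set} (x : A) q → ∃ λ I → x ∷ q ≡ I ++ [ lastOf x q ]
  lastOf-snoc x [] = [] , refl
  lastOf-snoc x (y ∷ q) with lastOf-snoc y q
  ... | I , eq = x ∷ I , cong (x ∷_) eq

  lastOf-∈ : ∀ {A : Set} (x : A) q → lastOf x q ∈ˡ x ∷ q
  lastOf-∈ x [] = here refl
  lastOf-∈ x (y ∷ q) = there (lastOf-∈ y q)

  lastSplit : ∀ {A : Set} {P : A → Set} → Decidable P → ∀ xs → Any P xs →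
              ∃ λ A' → ∃ λ c → ∃ λ B → xs ≡ A' ++ c ∷ B × P c × All (λ y → ¬ P y) B
  lastSplit P? (x ∷ xs) a with any? P? xs
  ... | yes a' with lastSplit P? xs a'
  ...   | A' , c , B , eq , pc , al = x ∷ A' , c , B , cong (x ∷_) eq , pc , al
  lastSplit P? (x ∷ xs) (here px) | no na = [] , x , xs , refl , px , ¬Any⇒All¬ xs na
  lastSplit P? (x ∷ xs) (there a) | no na = ⊥-elim (na a)

  avoidTwo : ∀ {m} {x1 x2 x3 : Fin m} (a b : Fin m) → x1 ≢ x2 → x1 ≢ x3 → x2 ≢ x3 →
          ∃ λ t → (t ≡ x1 ⊎ t ≡ x2 ⊎ t ≡ x3) × t ≢ a × t ≢ b
  avoidTwo {x1 = x1} {x2} {x3} a b d12 d13 d23 with x1 ≟ a | x1 ≟ b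
  ... | no n1a | no n1b = x1 , inj₁ refl , n1a , n1b
  ... | yes refl | _ with x2 ≟ b
  ...   | no n2b = x2 , inj₂ (inj₁ refl) , (λ e → d12 (sym e)) , n2b
  ...   | yes refl = x3 , inj₂ (inj₂ refl) , (λ e → d13 (sym e)) , (λ e → d23 (sym e))
  avoidTwo {x1 = x1} {x2} {x3} a b d12 d13 d23 | no n1a | yes refl with x2 ≟ a
  ...   | no n2a = x2 , inj₂ (inj₁ refl) , n2a , (λ e → d12 (sym e))
  ...   | yes refl = x3 , inj₂ (inj₂ refl) , (λ e → d23 (sym e)) , (λ e → d13 (sym e))


  module _ {n : ℕ} (G : Graph n) where

    exitEdge : ∀ {S R : Subset n} {z t} → Reach G S z t → z ∉ R → t ∈ R →
          ∃ λ p → ∃ λ q → Reach G (S ─ R) z p × Edge G p q × q ∈ R × q ∈ S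
    exitEdge (here h) nz ht = ⊥-elim (nz ht)
    exitEdge {R = R} {z = z} (step {y = y} h e r) nz ht with y ∈? R
    ... | yes yR = z , y , here (x∈p∧x∉q⇒x∈p─q h nz) , e , yR , reach-start G r
    ... | no nyR with exitEdge r nyR ht
    ...   | p , q , r' , e' , qR , qS = p , q , step (x∈p∧x∉q⇒x∈p─q h nz) e r' , e' , qR , qS

    -- every walk contains an induced path with the same ends: jump from a to the last vertex
    -- on the (inductively obtained) induced path that is a or a neighbour of a
    walk⇒IPath : ∀ {S a b} → Reach G S a b → ∃ λ q → IPath G (a ∷ q) × All (_∈ S) (a ∷ q) × lastOf a q ≡ b
    walk⇒IPath (here h) = [] , tt , h ∷ [] , refl
    walk⇒IPath {S} {a} {b} (step {y = y} h e r) with walk⇒IPath r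
    ... | q' , ip' , al' , la' with lastSplit (λ c → (c ≟ a) ⊎-dec Edge? G a c) (y ∷ q') (here (inj₂ e))
    ...   | A' , c , B , eq , pc , alB = jump pc
      where
      ipc : IPath G (c ∷ B)
      ipc = proj₂ (IPath-++⁻ G A' (subst (IPath G) eq ip'))
      alc : All (_∈ S) (c ∷ B)
      alc = AllP.++⁻ʳ A' (subst (All (_∈ S)) eq al')
      lst : ∀ A'' → y ∷ q' ≡ A'' ++ c ∷ B → lastOf c B ≡ b
      lst [] refl = la'
      lst (w ∷ A'') refl = trans (sym (lastOf-++ A'' B)) la'
      jump : c ≡ a ⊎ Edge G a c → ∃ λ q → IPath G (a ∷ q) × All (_∈ S) (a ∷ q) × lastOf a q ≡ b
      jump (inj₁ refl) = B , ipc , alc , lst A' eq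
      jump (inj₂ eac) = c ∷ B , (eac , All-map (λ np ea → np (inj₂ ea)) alB ,
                               (λ { (here refl) → Edge-irr G eac ; (there m) → All-lookup alB m (inj₁ refl) }) , ipc) ,
                       h ∷ alc , lst A' eq

    -- if x is adjacent to both ends of an induced path avoiding x, then x closes an induced
    -- cycle with an initial part of the path (up to the first further neighbour of x)
    closeCycle : ∀ {x a y q'} → x ∉ˡ (a ∷ y ∷ q') → IPath G (a ∷ y ∷ q') → Edge G x a → Edge G x (lastOf y q') →
                  ∃ λ p → ICycle G x p × All (_∈ˡ a ∷ y ∷ q') p
    closeCycle {x} {a} {y} {q'} nx ip exa exl with first (Edge? G x) (y ∷ q') (Any.map (λ { refl → exl }) (lastOf-∈ y q'))
    ... | ws , c , zs , eq , exc , naw = a ∷ ws ++ [ c ] , (ipp , nxp , exa , OnlyLast-snoc G ws naw exc) , allp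
      where
      eql : a ∷ y ∷ q' ≡ (a ∷ ws ++ [ c ]) ++ zs
      eql = cong (a ∷_) (trans eq (sym (++-assoc ws [ c ] zs)))
      ipp : IPath G (a ∷ ws ++ [ c ])
      ipp = proj₁ (IPath-++⁻ G (a ∷ ws ++ [ c ]) (subst (IPath G) eql ip))
      sub' : ∀ {w} → w ∈ˡ a ∷ ws ++ [ c ] → w ∈ˡ a ∷ y ∷ q'
      sub' {w} m = subst (w ∈ˡ_) (sym eql) (∈-++⁺ˡ m)
      nxp : x ∉ˡ a ∷ ws ++ [ c ]
      nxp m = nx (sub' m)
      allp : All (_∈ˡ a ∷ y ∷ q') (a ∷ ws ++ [ c ])
      allp = All-tab sub'

    rotateTo : ∀ {v p a} → ICycle G v p → a ∈ˡ v ∷ p →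
            ∃ λ L → ICycle G a L × (∀ {w} → w ∈ˡ a ∷ L → w ∈ˡ v ∷ p) × (∀ {w} → w ∈ˡ v ∷ p → w ∈ˡ a ∷ L)
    rotateTo c (here refl) = _ , c , (λ m → m) , (λ m → m)
    rotateTo {v} {p} {a} c (there m) with ∈-∃++ m
    ... | P1 , P2 , refl = P2 ++ v ∷ P1 , rotate G P1 c , back , fwd
      where
      fwd : ∀ {w} → w ∈ˡ v ∷ P1 ++ a ∷ P2 → w ∈ˡ a ∷ P2 ++ v ∷ P1
      fwd (here refl) = there (∈-++⁺ʳ P2 (here refl))
      fwd (there m') with ∈-++⁻ P1 m'
      ... | inj₁ m2 = there (∈-++⁺ʳ P2 (there m2))
      ... | inj₂ (here refl) = here refl
      ... | inj₂ (there m2) = there (∈-++⁺ˡ m2)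
      back : ∀ {w} → w ∈ˡ a ∷ P2 ++ v ∷ P1 → w ∈ˡ v ∷ P1 ++ a ∷ P2
      back (here refl) = there (∈-++⁺ʳ P1 (here refl))
      back (there m') with ∈-++⁻ P2 m'
      ... | inj₁ m2 = there (∈-++⁺ʳ P1 (there m2))
      ... | inj₂ (here refl) = here refl
      ... | inj₂ (there m2) = there (∈-++⁺ˡ m2)

-- Let H be connected, with two distinct vertices u, v, no cut
-- vertex and no separating edge.  If H has no third vertex it is an edge ('twoVertices⇒K2').
-- Otherwise some x ∈ H has two distinct neighbours a, b, and an induced a–b path in H ─ {x}
-- closes an induced cycle C through x ('cycleIn').  In an SC_k graph (k odd, k ≠ 3) a vertex
-- z ∈ H outside C is attached to C by walks avoiding C; using that H has no cut vertex and
-- no separating edge, z has two non-adjacent attachments, which span an ear of C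
-- ('cycleSpans').  So C covers H, and H is an induced k-cycle ('spanning⇒Ck').
module FinalPieces where

  open import Defs
  open Basics
  open Paths
  open CycleLists
  open Ears
  open Extraction
  open import Data.Nat using (ℕ; _+_)
  open import Data.Fin using (Fin; _≟_)
  open import Data.Fin.Subset using (Subset; _∈_; _⊆_; _∪_; _─_; ⁅_⁆)
  open import Data.Fin.Subset.Properties using (_∈?_; x∈p∧x∉q⇒x∈p─q; p─q⊆p; ⊆-antisym)
  open import Data.Fin.Properties using (any?)
  open import Data.List using (List; []; _∷_; _++_; [_]; lookup)
  open import Data.List.Properties using (∷-injective)
  open import Data.List.Relation.Unary.All using (All; _∷_) renaming (lookup to All-lookup; tabulate to All-tab; map to All-map)
  open import Data.List.Relation.Unary.Any using (here; there; index)
  open import Data.List.Relation.Unary.Any.Properties using (lookup-index)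
  open import Data.List.Membership.Propositional using () renaming (_∈_ to _∈ˡ_; _∉_ to _∉ˡ_)
  open import Data.List.Membership.Propositional.Properties using (∈-++⁺ˡ; ∈-∃++; ∈-lookup)
  open import Data.Product using (∃; _×_; _,_; proj₁; proj₂)
  open import Data.Sum using (_⊎_; inj₁; inj₂; [_,_]′)
  open import Data.Empty using (⊥; ⊥-elim)
  open import Relation.Nullary using (¬_; yes; no; _×-dec_; ¬?)
  open import Function.Bundles using (mk⇔)
  open import Relation.Binary.PropositionalEquality using (_≡_; _≢_; ≢-sym; refl; sym; trans; cong; subst)

  module _ {n : ℕ} (G : Graph n) where

    firstStep : ∀ {H : Subset n} {u v} → Reach G H u v → u ≢ v → ∃ λ y → Edge G u y × y ∈ H
    firstStep (here _) u≢v = ⊥-elim (u≢v refl)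
    firstStep (step _ e r) _ = _ , e , reach-start G r

    twoVertices⇒K2 : ∀ {H : Subset n} {u v} → Connected G H → u ∈ H → v ∈ H → u ≢ v →
                     (∀ w → w ∈ H → w ≡ u ⊎ w ≡ v) → IsK2 G H
    twoVertices⇒K2 {H} {u} {v} conn uH vH u≢v only with firstStep (conn u v uH vH) u≢v
    ... | y , euy , yH with only y yH
    ...   | inj₁ refl = ⊥-elim (Edge-irr G euy)
    ...   | inj₂ refl =
            u , y , u≢v , euy , ⊆-antisym (λ {w} wH → ∈uv⁺ (only w wH)) (λ h → [ (λ { refl → uH }) , (λ { refl → yH }) ]′ (∈uv⁻ h))

    branchVertex : ∀ {H : Subset n} {u v w} → Connected G H → u ∈ H → v ∈ H → w ∈ H → u ≢ v → w ≢ u → w ≢ v →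
                   ∃ λ x → ∃ λ a → ∃ λ b → x ∈ H × a ∈ H × b ∈ H × a ≢ b × Edge G x a × Edge G x b
    branchVertex {H} {u} {v} {w} conn uH vH wH u≢v w≢u w≢v with firstStep (conn u v uH vH) u≢v
    ... | y , euy , yH = fromThird third
      where
      third : ∃ λ z → z ∈ H × z ≢ u × z ≢ y
      third with y ≟ v
      ... | yes refl = w , wH , w≢u , w≢v
      ... | no y≢v = v , vH , ≢-sym u≢v , ≢-sym y≢v
      -- a walk from the third vertex z to the edge uy enters it along an edge pq
      fromThird : (∃ λ z → z ∈ H × z ≢ u × z ≢ y) →
                  ∃ λ x → ∃ λ a → ∃ λ b → x ∈ H × a ∈ H × b ∈ H × a ≢ b × Edge G x a × Edge G x b
      fromThird (z , zH , z≢u , z≢y)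
        with exitEdge G {R = ⁅ u ⁆ ∪ ⁅ y ⁆} (conn z u zH uH) (λ h → [ z≢u , z≢y ]′ (∈uv⁻ h)) (∈uv⁺ (inj₁ refl))
      ... | p , q , rp , epq , qR , qH with ∈─uv⁻ (reach-end G rp)
      ...   | pH , p≢u , p≢y with ∈uv⁻ qR
      ...     | inj₁ refl = u , y , p , uH , yH , pH , ≢-sym p≢y , euy , Edge-sym G epq
      ...     | inj₂ refl = y , u , p , yH , uH , pH , ≢-sym p≢u , Edge-sym G euy , Edge-sym G epq

    cycleIn : ∀ {H : Subset n} {u v w} → Connected G H → (∀ x → x ∈ H → Connected G (H ─ ⁅ x ⁆)) →
              u ∈ H → v ∈ H → w ∈ H → u ≢ v → w ≢ u → w ≢ v →
              ∃ λ x → ∃ λ p → ICycle G x p × All (_∈ H) (x ∷ p)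
    cycleIn conn noCut uH vH wH u≢v w≢u w≢v with branchVertex conn uH vH wH u≢v w≢u w≢v
    ... | x , a , b , xH , aH , bH , a≢b , exa , exb
      with walk⇒IPath G (noCut x xH a b (∈─⁅⁆⁺ aH (≢-sym (Edge-≢ G exa))) (∈─⁅⁆⁺ bH (≢-sym (Edge-≢ G exb))))
    ...   | [] , _ , _ , a≡b = ⊥-elim (a≢b a≡b)
    ...   | y ∷ q , path , inH─x , last≡b
      with closeCycle G (λ m → proj₂ (∈─⁅⁆⁻ (All-lookup inH─x m)) refl) path exa (subst (Edge G x) (sym last≡b) exb)
    ...     | p , cyc , onPath = x , p , cyc , xH ∷ All-map (λ m → proj₁ (∈─⁅⁆⁻ (All-lookup inH─x m))) onPath

  module Shape {n : ℕ} (G : Graph n) (k : ℕ) (sc : SC G k) (k≢3 : k ≢ 3) (k-odd : ∀ q → q + q ≢ k) where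
    open NoEar G k sc k≢3 k-odd

    NoCut : Subset n → Set
    NoCut H = ∀ x → x ∈ H → Connected G (H ─ ⁅ x ⁆)

    NoSepEdge : Subset n → Set
    NoSepEdge H = ∀ u v → ¬ SepEdge G H u v

    Attached : Subset n → List (Fin n) → Fin n → Fin n → Set
    Attached H cl z a = a ∈ˡ cl × ∃ λ d → Edge G d a × Reach G (H ─ fromList cl) z d

    attach : ∀ {H S : Subset n} {cl z t} → S ⊆ H → Reach G S z t → z ∉ˡ cl → t ∈ˡ cl →
             ∃ λ a → a ∈ S × Attached H cl z a
    attach {H} {S} {cl} S⊆H r z∉cl t∈cl with exitEdge G r (λ h → z∉cl (fromList⁻ h)) (fromList⁺ t∈cl)
    ... | d , a , rd , eda , aR , aS = a , aS , fromList⁻ aR , d , eda , reach-mono G outside rd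
      where
      outside : S ─ fromList cl ⊆ H ─ fromList cl
      outside h with ∈─⁻ S (fromList cl) h
      ... | hS , h∉ = x∈p∧x∉q⇒x∈p─q (S⊆H hS) h∉

    -- two non-adjacent attachments a', b' of z: an induced a'–b' path through z's side is an ear
    earFromAttachments : ∀ {H : Subset n} {v p z a' b'} → ICycle G v p →
                         Attached H (v ∷ p) z a' → Attached H (v ∷ p) z b' → a' ≢ b' → ¬ Edge G a' b' → ⊥
    earFromAttachments {H} {v} {p} {z} {a'} {b'} cyc (ma , d , eda , r1) (mb , d' , edb , r2) a'≢b' a'≁b'
      with walk⇒IPath G walk
      where
      R = fromList (v ∷ p)
      walk : Reach G ((H ─ R) ∪ (⁅ a' ⁆ ∪ ⁅ b' ⁆)) a' b'
      walk = step (∈∪uv⁺ (inj₂ (inj₁ refl))) (Edge-sym G eda)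
               (reach-snoc G (reach-mono G (λ h → ∈∪uv⁺ (inj₁ h)) (reach-trans G (reach-sym G r1) r2))
                 edb (∈∪uv⁺ (inj₂ (inj₂ refl))))
    ... | q , ipq , inS , lq with lastOf-snoc a' q
    ...   | [] , eqI = a'≢b' (trans (proj₁ (∷-injective eqI)) lq)
    ...   | (_ ∷ xs) , eqI = noEar ear
      where
      R = fromList (v ∷ p)
      q≡ : q ≡ xs ++ [ b' ]
      q≡ = trans (proj₂ (∷-injective eqI)) (cong (λ t → xs ++ [ t ]) lq)
      pth : IPath G (a' ∷ xs ++ [ b' ])
      pth = subst (λ t → IPath G (a' ∷ t)) q≡ ipq
      xsOut : ∀ {w} → w ∈ˡ xs → w ∉ˡ v ∷ p
      xsOut {w} m wm with ∈∪uv⁻ (H ─ R) (All-lookup inS (there (subst (w ∈ˡ_) (sym q≡) (∈-++⁺ˡ m))))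
      ... | inj₁ h = proj₂ (∈─⁻ H R h) (fromList⁺ wm)
      ... | inj₂ (inj₁ refl) = IPath-head∉ G pth (∈-++⁺ˡ m)
      ... | inj₂ (inj₂ refl) = IPath-last∉ G xs (IPath-tail G pth) m
      rotated = rotateTo G cyc ma
      L = proj₁ rotated
      b'∈L : b' ∈ˡ L
      b'∈L with proj₂ (proj₂ (proj₂ rotated)) mb
      ... | here e = ⊥-elim (a'≢b' (sym e))
      ... | there m = m
      atB = ∈-∃++ b'∈L
      ear : Ear
      ear = record
        { a = a' ; b = b' ; L1 = proj₁ atB ; L2 = proj₁ (proj₂ atB) ; xs = xs
        ; cyc = subst (ICycle G a') (proj₂ (proj₂ atB)) (proj₁ (proj₂ rotated))
        ; nab = a'≁b'
        ; path = pth
        ; disj = All-tab λ m m2 → xsOut m (proj₁ (proj₂ (proj₂ rotated)) (there (subst (_ ∈ˡ_) (sym (proj₂ (proj₂ atB))) m2)))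
        }

    cycleSpans : ∀ {H : Subset n} {v p z} → ICycle G v p → All (_∈ H) (v ∷ p) → z ∈ H → z ∉ˡ v ∷ p →
                 Connected G H → NoCut H → NoSepEdge H → ⊥
    cycleSpans {p = []} (_ , _ , ()) _ _ _ _ _ _
    cycleSpans {p = _ ∷ []} (_ , _ , _ , ()) _ _ _ _ _ _
    cycleSpans {H} {v} {p0 ∷ p1 ∷ p'} {z} cyc@(ip , v∉ , _) inH zH z∉ conn noCut noSep = firstAttachments
      where
      cl = v ∷ p0 ∷ p1 ∷ p'
      v≢p0 : v ≢ p0
      v≢p0 e = v∉ (here e)
      v≢p1 : v ≢ p1
      v≢p1 e = v∉ (there (here e))
      p0≢p1 : p0 ≢ p1
      p0≢p1 e = IPath-head∉ G ip (here e)
      z≢ : ∀ {w} → w ∈ˡ cl → z ≢ w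
      z≢ m refl = z∉ m
      three : ∀ {w} → w ≡ v ⊎ w ≡ p0 ⊎ w ≡ p1 → w ∈ˡ cl
      three (inj₁ refl) = here refl
      three (inj₂ (inj₁ refl)) = there (here refl)
      three (inj₂ (inj₂ refl)) = there (there (here refl))
      onC : ∀ {w} → w ≡ v ⊎ w ≡ p0 ⊎ w ≡ p1 → w ∈ H
      onC t = All-lookup inH (three t)
      -- z is attached at some a, and, as a is no cut vertex, at some b ≠ a; if a ~ b then,
      -- as {a, b} does not separate, z has a third attachment c', and c' ≁ a or c' ≁ b
      firstAttachments : ⊥
      firstAttachments with attach (λ h → h) (conn z v zH (All-lookup inH (here refl))) z∉ (here refl)
      ... | a , aH , att-a with avoidTwo a a v≢p0 v≢p1 p0≢p1
      ...   | t , t∈ , t≢a , _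
        with attach (p─q⊆p H _) (noCut a aH z t (∈─⁅⁆⁺ zH (z≢ (proj₁ att-a))) (∈─⁅⁆⁺ (onC t∈) t≢a)) z∉ (three t∈)
      ...     | b , bH─a , att-b with ∈─⁅⁆⁻ bH─a
      ...       | bH , b≢a with Edge? G a b
      ...         | no a≁b = earFromAttachments cyc att-a att-b (≢-sym b≢a) a≁b
      ...         | yes a~b = noSep a b (aH , bH , a~b , thirdAttachment)
        where
        thirdAttachment : ¬ Connected G (H ─ (⁅ a ⁆ ∪ ⁅ b ⁆))
        thirdAttachment conn' with avoidTwo a b v≢p0 v≢p1 p0≢p1
        ... | t' , t'∈ , t'≢a , t'≢b
          with attach (λ h → proj₁ (∈─uv⁻ h))
                 (conn' z t' (∈─uv⁺ zH (z≢ (proj₁ att-a)) (z≢ (proj₁ att-b))) (∈─uv⁺ (onC t'∈) t'≢a t'≢b)) z∉ (three t'∈)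
        ...   | c' , c'H─ab , att-c with ∈─uv⁻ c'H─ab
        ...     | _ , c'≢a , c'≢b with Edge? G a c' | Edge? G b c'
        ...       | no a≁c' | _ = earFromAttachments cyc att-a att-c (≢-sym c'≢a) a≁c'
        ...       | yes _ | no b≁c' = earFromAttachments cyc att-b att-c (≢-sym c'≢b) b≁c'
        ...       | yes a~c' | yes b~c' = noTriangle a~b b~c' a~c'

    spanning⇒Ck : ∀ {H : Subset n} {x p} → ICycle G x p → All (_∈ H) (x ∷ p) → (∀ z → z ∈ H → z ∈ˡ x ∷ p) → IsCk G k H
    spanning⇒Ck {H} {x} {p} cyc inH covers =
      subst (λ ℓ → IsCk G ℓ H) (ICycle-length G sc cyc)
        (lookup (x ∷ p) , ICycle⇒induced G cyc ,
         λ z → mk⇔ (λ zH → index (covers z zH) , sym (lookup-index (covers z zH)))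
                   (λ { (i , refl) → All-lookup inH (∈-lookup i) }))

    finalPiece-shape : ∀ (H : Subset n) u v → u ∈ H → v ∈ H → u ≢ v → Connected G H → NoCut H → NoSepEdge H →
                       IsK2 G H ⊎ IsCk G k H
    finalPiece-shape H u v uH vH u≢v conn noCut noSep
      with any? (λ w → (w ∈? H) ×-dec (¬? (w ≟ u)) ×-dec (¬? (w ≟ v)))
    ... | no noThird = inj₁ (twoVertices⇒K2 G conn uH vH u≢v only)
      where
      only : ∀ w → w ∈ H → w ≡ u ⊎ w ≡ v
      only w wH with w ≟ u | w ≟ v
      ... | yes w≡u | _ = inj₁ w≡u
      ... | no _ | yes w≡v = inj₂ w≡v
      ... | no w≢u | no w≢v = ⊥-elim (noThird (w , wH , w≢u , w≢v))
    ... | yes (w , wH , w≢u , w≢v) with cycleIn G conn noCut uH vH wH u≢v w≢u w≢v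
    ...   | x , p , cyc , inH = inj₂ (spanning⇒Ck cyc inH covers)
      where
      covers : ∀ z → z ∈ H → z ∈ˡ x ∷ p
      covers z zH with z ∈ˡ? (x ∷ p)
      ... | yes m = m
      ... | no z∉ = ⊥-elim (cycleSpans cyc inH zH z∉ conn noCut noSep)

-- Blocks are connected by definition and contain an edge; a new
-- piece C ∪ {u,v} is connected because every vertex of the component C reaches the edge uv.
module Splitting where

  open import Defs
  open Basics
  open Paths
  open CycleLists
  open Extraction
  open import Data.Nat using (ℕ; zero; suc; _≤_; s≤s)
  open import Data.Fin using (Fin; zero; suc; _≟_)
  open import Data.Fin.Subset using (Subset; _∈_; _⊆_; _∪_; _─_; ⁅_⁆; ⊤; inside)
  open import Data.Fin.Subset.Properties using (_∈?_; x∈⁅x⁆; x∈⁅y⁆⇒x≡y; x∈p∪q⁺; x∈p∪q⁻; ∈⊤; p⊆p∪q)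
  open import Data.Fin.Properties using (any?)
  open import Data.List using (List)
  open import Data.List.Relation.Unary.Any using (Any; here; there)
  open import Data.List.Membership.Propositional using () renaming (_∈_ to _∈ˡ_; _∉_ to _∉ˡ_)
  open import Data.List.Membership.Propositional.Properties using (∈-++⁺ˡ; ∈-++⁺ʳ; ∈-++⁻)
  open import Data.Product using (∃; _×_; _,_; proj₁)
  open import Data.Sum using (_⊎_; inj₁; inj₂)
  open import Data.Empty using (⊥; ⊥-elim)
  open import Relation.Nullary using (yes; no; _×-dec_; ¬?)
  open import Function.Bundles using (module Equivalence)
  open Equivalence using (to)
  open import Relation.Binary.PropositionalEquality using (_≡_; _≢_; refl; sym; subst)

  module _ {n : ℕ} (G : Graph n) where

    compStep : ∀ {R C : Subset n} {c y} → Component G R C → c ∈ C → y ∈ R → Edge G c y → y ∈ C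
    compStep {R} {C} {c} {y} (ne , CR , Cc , maximal) hc hy e = maximal (C ∪ ⁅ y ⁆) (p⊆p∪q _) TR Tc (x∈p∪q⁺ (inj₂ (x∈⁅x⁆ y)))
      where
      T = C ∪ ⁅ y ⁆
      CT : ∀ {w} → w ∈ C → w ∈ T
      CT h = x∈p∪q⁺ (inj₁ h)
      TR : T ⊆ R
      TR h with x∈p∪q⁻ C ⁅ y ⁆ h
      ... | inj₁ h' = CR h'
      ... | inj₂ h' = subst (_∈ R) (sym (x∈⁅y⁆⇒x≡y y h')) hy
      yT : y ∈ T
      yT = x∈p∪q⁺ (inj₂ (x∈⁅x⁆ y))
      toY : ∀ {s} → s ∈ C → Reach G T s y
      toY hs = reach-snoc G (reach-mono G CT (Cc _ c hs hc)) e yT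
      Tc : Connected G T
      Tc s t hs ht with x∈p∪q⁻ C ⁅ y ⁆ hs | x∈p∪q⁻ C ⁅ y ⁆ ht
      ... | inj₁ a | inj₁ b = reach-mono G CT (Cc s t a b)
      ... | inj₁ a | inj₂ b rewrite x∈⁅y⁆⇒x≡y y b = toY a
      ... | inj₂ a | inj₁ b rewrite x∈⁅y⁆⇒x≡y y a = reach-sym G (toY b)
      ... | inj₂ a | inj₂ b rewrite x∈⁅y⁆⇒x≡y y a | x∈⁅y⁆⇒x≡y y b = here yT

    compWalk : ∀ {R C : Subset n} {c w} → Component G R C → c ∈ C → Reach G R c w → Reach G C c w
    compWalk cp hc (here _) = here hc
    compWalk cp hc (step h e r) = step hc e (compWalk cp (compStep cp hc (reach-start G r) e) r)

    Comp⊆ : ∀ {R C : Subset n} → Component G R C → ∀ {w} → w ∈ C → w ∈ R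
    Comp⊆ (_ , CR , _) h = CR h

    splitPiece-reach-u : ∀ {H C : Subset n} {u v} → Connected G H → u ∈ H → v ∈ H → Edge G u v →
               Component G (H ─ (⁅ u ⁆ ∪ ⁅ v ⁆)) C → ∀ w → w ∈ C ∪ (⁅ u ⁆ ∪ ⁅ v ⁆) →
               Reach G (C ∪ (⁅ u ⁆ ∪ ⁅ v ⁆)) w u
    splitPiece-reach-u {H} {C} {u} {v} conn uH vH euv cp w hw with ∈∪uv⁻ C hw
    ... | inj₂ (inj₁ refl) = here hw
    ... | inj₂ (inj₂ refl) = reach-edge G hw (∈∪uv⁺ (inj₂ (inj₁ refl))) (Edge-sym G euv)
    ... | inj₁ wC with ∈─uv⁻ (Comp⊆ cp wC)
    ...   | wH , wu , wv with exitEdge G {R = ⁅ u ⁆ ∪ ⁅ v ⁆} (conn w u wH uH) (λ h → notR (∈uv⁻ h)) (x∈p∪q⁺ (inj₁ (x∈⁅x⁆ u)))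
      where
      notR : w ≡ u ⊎ w ≡ v → ⊥
      notR (inj₁ e) = wu e
      notR (inj₂ e) = wv e
    ...     | p , q , rp , epq , qR , qH = reach-trans G (reach-mono G (λ h → ∈∪uv⁺ (inj₁ h)) (compWalk cp wC rp)) (step (∈∪uv⁺ (inj₁ (reach-end G (compWalk cp wC rp)))) epq (qu (∈uv⁻ qR)))
      where
      qu : q ≡ u ⊎ q ≡ v → Reach G (C ∪ (⁅ u ⁆ ∪ ⁅ v ⁆)) q u
      qu (inj₁ refl) = here (∈∪uv⁺ (inj₂ (inj₁ refl)))
      qu (inj₂ refl) = reach-edge G (∈∪uv⁺ (inj₂ (inj₂ refl))) (∈∪uv⁺ (inj₂ (inj₁ refl))) (Edge-sym G euv)

    splitPiece-connected : ∀ {H C : Subset n} {u v} → Connected G H → u ∈ H → v ∈ H → Edge G u v →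
                Component G (H ─ (⁅ u ⁆ ∪ ⁅ v ⁆)) C → Connected G (C ∪ (⁅ u ⁆ ∪ ⁅ v ⁆))
    splitPiece-connected conn uH vH euv cp s t hs ht =
      reach-trans G (splitPiece-reach-u conn uH vH euv cp s hs) (reach-sym G (splitPiece-reach-u conn uH vH euv cp t ht))

    edge-noCutVertex : ∀ {x y} → Edge G x y → NoCutVertex G (⁅ x ⁆ ∪ ⁅ y ⁆)
    edge-noCutVertex {x} {y} e = conn , λ w hw s t hs ht → cut w hw s t hs ht
      where
      T = ⁅ x ⁆ ∪ ⁅ y ⁆
      xT : x ∈ T
      xT = x∈p∪q⁺ (inj₁ (x∈⁅x⁆ x))
      yT : y ∈ T
      yT = x∈p∪q⁺ (inj₂ (x∈⁅x⁆ y))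
      el : ∀ {s} → s ∈ T → s ≡ x ⊎ s ≡ y
      el = ∈uv⁻
      conn : Connected G T
      conn s t hs ht with el hs | el ht
      ... | inj₁ refl | inj₁ refl = here hs
      ... | inj₁ refl | inj₂ refl = reach-edge G xT yT e
      ... | inj₂ refl | inj₁ refl = reach-edge G yT xT (Edge-sym G e)
      ... | inj₂ refl | inj₂ refl = here hs
      cut : ∀ w → w ∈ T → Connected G (T ─ ⁅ w ⁆)
      cut w hw s t hs ht with ∈─⁅⁆⁻ hs | ∈─⁅⁆⁻ ht
      ... | s1 , sw | t1 , tw with el s1 | el t1 | el hw
      ...   | inj₁ refl | inj₁ refl | _ = here hs
      ...   | inj₂ refl | inj₂ refl | _ = here hs
      ...   | inj₁ refl | inj₂ refl | inj₁ refl = ⊥-elim (sw refl)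
      ...   | inj₁ refl | inj₂ refl | inj₂ refl = ⊥-elim (tw refl)
      ...   | inj₂ refl | inj₁ refl | inj₁ refl = ⊥-elim (tw refl)
      ...   | inj₂ refl | inj₁ refl | inj₂ refl = ⊥-elim (sw refl)

    neighbour : 2 ≤ n → Connected G ⊤ → ∀ x → ∃ λ y → Edge G x y
    neighbour le conn x with outsideVertex le x
      where
      outsideVertex : 2 ≤ n → ∀ (x : Fin n) → ∃ λ z → z ≢ x
      outsideVertex (s≤s (s≤s _)) zero = suc zero , λ ()
      outsideVertex (s≤s (s≤s _)) (suc x) = zero , λ ()
    ... | z , zx with conn x z ∈⊤ ∈⊤
    ...   | here _ = ⊥-elim (zx refl)
    ...   | step _ e _ = _ , e

    vertex₀ : 2 ≤ n → Fin n
    vertex₀ (s≤s (s≤s _)) = zero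

    -- a block is non-empty and not a single vertex x: both ∅ and {x} lie inside an edge
    -- {x, y}, which has no cut vertex, contradicting maximality
    block-two-vertices : 2 ≤ n → Connected G ⊤ → ∀ {S} → Block G S → ∃ λ u → ∃ λ v → u ∈ S × v ∈ S × u ≢ v
    block-two-vertices le conn {S} (ncv , maximal) with any? (λ x → x ∈? S)
    ... | no ne with neighbour le conn (vertex₀ le)
    ...   | y , e = ⊥-elim (ne (vertex₀ le , maximal _ (λ h → ⊥-elim (ne (_ , h))) (edge-noCutVertex e) (x∈p∪q⁺ (inj₁ (x∈⁅x⁆ (vertex₀ le))))))
    block-two-vertices le conn {S} (ncv , maximal) | yes (x , hx) with any? (λ z → (z ∈? S) ×-dec ¬? (z ≟ x))
    ... | yes (z , hz , zx) = z , x , hz , hx , zx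
    ... | no nz with neighbour le conn x
    ...   | y , e = ⊥-elim (Edge-≢ G e (sym yx))
      where
      S⊆xy : S ⊆ (⁅ x ⁆ ∪ ⁅ y ⁆)
      S⊆xy {w} h with w ≟ x
      ... | yes refl = x∈p∪q⁺ (inj₁ (x∈⁅x⁆ w))
      ... | no wx = ⊥-elim (nz (w , h , wx))
      yS : y ∈ S
      yS = maximal _ S⊆xy (edge-noCutVertex e) (x∈p∪q⁺ (inj₂ (x∈⁅x⁆ y)))
      yx : y ≡ x
      yx with y ≟ x
      ... | yes q = q
      ... | no q = ⊥-elim (nz (y , yS , q))

    PieceInv : Subset n → Set
    PieceInv H = Connected G H × ∃ λ u → ∃ λ v → u ∈ H × v ∈ H × u ≢ v

    piece-invariant : 2 ≤ n → Connected G ⊤ → ∀ {L} → Reachable G L → ∀ H → H ∈ˡ L → PieceInv H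
    piece-invariant le conn (start L iff) H m with to (iff H) m
    ... | bl = proj₁ (proj₁ bl) , block-two-vertices le conn bl
    piece-invariant le conn (split L₁ H L₂ u v M r (uH , vH , euv , _) iff) P m with ∈-++⁻ L₁ m
    ... | inj₁ m1 = piece-invariant le conn r P (∈-++⁺ˡ m1)
    ... | inj₂ m2 with ∈-++⁻ M m2
    ...   | inj₂ m3 = piece-invariant le conn r P (∈-++⁺ʳ L₁ (there m3))
    ...   | inj₁ m3 with to (iff P) m3
    ...     | C , cp , refl with piece-invariant le conn r H (∈-++⁺ʳ L₁ (here refl))
    ...       | connH , _ = splitPiece-connected connH uH vH euv cp , u , v , ∈∪uv⁺ (inj₂ (inj₁ refl)) , ∈∪uv⁺ (inj₂ (inj₂ refl)) , Edge-≢ G euv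

-- Lengths of induced cycles inside pieces: an induced cycle does not fit into an edge, and an
-- induced cycle whose vertices all lie on another induced cycle has the same length (the
-- second cycle minus a vertex outside the first would be an induced path containing it).
module CycleLength where

  open import Defs
  open Basics
  open Paths
  open CycleLists
  open Extraction
  open Splitting
  open import Data.Nat using (ℕ; zero; suc; s≤s)
  open import Data.Fin using (Fin; zero; suc; _≟_)
  open import Data.Fin.Subset using (Subset; _∈_; _∪_; ⁅_⁆; inside; outside)
  open import Data.Fin.Properties using (any?; cantor-schröder-bernstein; 0≢1+n; suc-injective)
  open import Data.List using (List; []; _∷_; _++_; [_]; tabulate)
  open import Data.List.Relation.Unary.All using (All; []; _∷_) renaming (lookup to All-lookup; tabulate to All-tab; map to All-map)
  open import Data.List.Relation.Unary.Any using (Any; here; there)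
  open import Data.List.Membership.Propositional using () renaming (_∈_ to _∈ˡ_; _∉_ to _∉ˡ_)
  open import Data.List.Membership.Propositional.Properties using (∈-++⁺ʳ; ∈-tabulate⁺; ∈-tabulate⁻)
  open import Data.Product using (∃; _,_; proj₁; proj₂)
  open import Data.Sum using (_⊎_; inj₁; inj₂)
  open import Data.Empty using (⊥; ⊥-elim)
  open import Relation.Nullary using (yes; no)
  open import Relation.Binary.PropositionalEquality using (_≡_; _≢_; refl; sym; trans; cong; subst)

  module _ {n : ℕ} (G : Graph n) where

    -- an induced path contains no induced cycle: drop path vertices off the cycle; the first
    -- vertex h on the cycle then has its two cycle neighbours later on the path, but h is
    -- adjacent only to the next path vertex
    noCycleInPath : ∀ {v p} q → ICycle G v p → IPath G q → All (_∈ˡ q) (v ∷ p) → ⊥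
    noCycleInPath [] c ip (() ∷ _)
    noCycleInPath {v} {p} (h ∷ q') c ip al with h ∈ˡ? (v ∷ p)
    ... | no nh = noCycleInPath q' c (IPath-tail G ip) (All-tab λ {x} m → drop (All-lookup al m) (λ e → nh (subst (_∈ˡ v ∷ p) e m)))
      where
      drop : ∀ {x} → x ∈ˡ h ∷ q' → x ≢ h → x ∈ˡ q'
      drop (here e) ne = ⊥-elim (ne e)
      drop (there m) _ = m
    ... | yes hm with rotateTo G c hm
    ...   | [] , (_ , _ , ()) , _
    ...   | (a ∷ L') , (ipL , hnin , eha , la) , back , fwd with OnlyLast-view G la
    ...     | L'' , b , refl , _ , ehb = bothOnRest q' ip aq bq
      where
      inq' : ∀ {x} → x ∈ˡ a ∷ L'' ++ [ b ] → Edge G h x → x ∈ˡ q'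
      inq' m e with All-lookup al (back (there m))
      ... | here refl = ⊥-elim (Edge-irr G e)
      ... | there m' = m'
      aq : a ∈ˡ q'
      aq = inq' (here refl) eha
      bq : b ∈ˡ q'
      bq = inq' (there (∈-++⁺ʳ L'' (here refl))) ehb
      anb : a ≢ b
      anb e = IPath-head∉ G ipL (subst (_∈ˡ L'' ++ [ b ]) (sym e) (∈-++⁺ʳ L'' (here refl)))
      bothOnRest : ∀ q' → IPath G (h ∷ q') → a ∈ˡ q' → b ∈ˡ q' → ⊥
      bothOnRest (h2 ∷ q'') (_ , na , _) (here refl) (here refl) = anb refl
      bothOnRest (h2 ∷ q'') (_ , na , _) (there m) _ = All-lookup na m eha
      bothOnRest (h2 ∷ q'') (_ , na , _) _ (there m) = All-lookup na m ehb

    cycleList-∈⁻ : ∀ {ℓ} (f : Fin (suc ℓ) → Fin n) {x} → x ∈ˡ f zero ∷ tabulate (λ i → f (suc i)) → ∃ λ i → f i ≡ x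
    cycleList-∈⁻ f (here refl) = zero , refl
    cycleList-∈⁻ f (there m) with ∈-tabulate⁻ m
    ... | i , refl = suc i , refl

    cycleList-∈⁺ : ∀ {ℓ} (f : Fin (suc ℓ) → Fin n) i → f i ∈ˡ f zero ∷ tabulate (λ i → f (suc i))
    cycleList-∈⁺ f zero = here refl
    cycleList-∈⁺ f (suc i) = there (∈-tabulate⁺ i)

    inducedCycles-sameLength : ∀ {ℓ k} {f : Fin (suc ℓ) → Fin n} {g : Fin (suc k) → Fin n} →
           IsInducedCycle G (suc ℓ) f → IsInducedCycle G (suc k) g → (∀ i → ∃ λ j → g j ≡ f i) → suc ℓ ≡ suc k
    inducedCycles-sameLength {ℓ} {k} {f} {g} cf cg fg = cantor-schröder-bernstein {f = h1} {g = h2} inj1 inj2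
      where
      h1 : Fin (suc ℓ) → Fin (suc k)
      h1 i = proj₁ (fg i)
      inj1 : ∀ {i i'} → h1 i ≡ h1 i' → i ≡ i'
      inj1 {i} {i'} e = proj₁ (proj₂ cf) (trans (sym (proj₂ (fg i))) (trans (cong g e) (proj₂ (fg i'))))
      gf : ∀ j → ∃ λ i → f i ≡ g j
      gf j with any? (λ i → f i ≟ g j)
      ... | yes r = r
      ... | no nr = ⊥-elim (noCycleInPath Lg (induced⇒ICycle G cf) (proj₁ cycg) allf)
        where
        cg' = induced⇒ICycle G cg
        rt = rotateTo G cg' (cycleList-∈⁺ g j)
        Lg = proj₁ rt
        cycg = proj₁ (proj₂ rt)
        fwd = proj₂ (proj₂ (proj₂ rt))
        allf : All (_∈ˡ Lg) (f zero ∷ tabulate (λ i → f (suc i)))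
        allf = All-tab λ m → onRest (cycleList-∈⁻ f m)
          where
          onRest : ∀ {x} → (∃ λ i → f i ≡ x) → x ∈ˡ Lg
          onRest (i , refl) with fwd (subst (_∈ˡ _) (proj₂ (fg i)) (cycleList-∈⁺ g (proj₁ (fg i))))
          ... | here e = ⊥-elim (nr (i , e))
          ... | there m = m
      h2 : Fin (suc k) → Fin (suc ℓ)
      h2 j = proj₁ (gf j)
      inj2 : ∀ {j j'} → h2 j ≡ h2 j' → j ≡ j'
      inj2 {j} {j'} e = proj₁ (proj₂ cg) (trans (sym (proj₂ (gf j))) (trans (cong f e) (proj₂ (gf j'))))

    noCycleInEdge : ∀ {ℓ} {f : Fin ℓ → Fin n} {u v} → IsInducedCycle G ℓ f → (∀ i → f i ∈ ⁅ u ⁆ ∪ ⁅ v ⁆) → ⊥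
    noCycleInEdge {suc (suc (suc ℓ))} {f} {u} {v} (_ , inj , _) inUV =
      pigeon (∈uv⁻ (inUV zero)) (∈uv⁻ (inUV (suc zero))) (∈uv⁻ (inUV (suc (suc zero))))
      where
      pigeon : f zero ≡ u ⊎ f zero ≡ v → f (suc zero) ≡ u ⊎ f (suc zero) ≡ v →
               f (suc (suc zero)) ≡ u ⊎ f (suc (suc zero)) ≡ v → ⊥
      pigeon (inj₁ a) (inj₁ b) _ = 0≢1+n (inj (trans a (sym b)))
      pigeon (inj₂ a) (inj₂ b) _ = 0≢1+n (inj (trans a (sym b)))
      pigeon (inj₁ a) _ (inj₁ c) = 0≢1+n (inj (trans a (sym c)))
      pigeon (inj₂ a) _ (inj₂ c) = 0≢1+n (inj (trans a (sym c)))
      pigeon _ (inj₁ b) (inj₁ c) = 0≢1+n (suc-injective (inj (trans b (sym c))))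
      pigeon _ (inj₂ b) (inj₂ c) = 0≢1+n (suc-injective (inj (trans b (sym c))))
    noCycleInEdge {zero} (() , _)
    noCycleInEdge {suc zero} (s≤s () , _)
    noCycleInEdge {suc (suc zero)} (s≤s (s≤s ()) , _)

-- Every notion involved is decidable, so the blocks can be
-- listed by enumerating all vertex sets, and the splitting process can be run: splitting a
-- piece without cut vertex along a separating edge uv yields strictly smaller pieces C ∪ {u,v}
-- without cut vertex ('Split'), so the process terminates ('process').
module Existence where

  open import Defs
  open Basics
  open Extraction
  open Splitting
  open import Data.Nat using (ℕ; zero; suc; _≤_; _<_; s≤s; _+_)
  open import Data.Nat.Properties using (<-≤-trans)
  open import Data.Fin using (Fin; zero; suc)
  open import Data.Fin.Subset using (Subset; _∈_; _∉_; _⊆_; _∪_; _─_; ⁅_⁆; ∣_∣; ∁; inside; outside)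
  open import Data.Fin.Subset.Properties using (_∈?_; _⊆?_; nonempty?; anySubset?; p⊂q⇒∣p∣<∣q∣; ∣p∣≤n; x∈∁p⇒x∉p; x∉p⇒x∈∁p; x∈p⇒x∉∁p; x∉∁p⇒x∈p; x∈p∧x∉q⇒x∈p─q)
  open import Data.Fin.Properties using (any?; all?; ¬∀⟶∃¬)
  open import Data.Vec using (Vec; []; _∷_)
  import Data.Vec as Vec
  open import Data.Bool using (Bool; true; false)
  open import Data.List using (List; []; _∷_; _++_; [_]; map; filter)
  open import Data.List.Properties using (++-assoc; ++-identityʳ)
  open import Data.List.Relation.Unary.All using (All; []; _∷_) renaming (lookup to All-lookup; tabulate to All-tab; map to All-map)
  open import Data.List.Relation.Unary.Any using (Any; here)
  open import Data.List.Membership.Propositional using () renaming (_∈_ to _∈ˡ_; _∉_ to _∉ˡ_)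
  open import Data.List.Membership.Propositional.Properties using (∈-++⁺ˡ; ∈-++⁺ʳ; ∈-map⁺; ∈-map⁻; ∈-filter⁺; ∈-filter⁻)
  open import Data.Product using (Σ; ∃; ∃-syntax; _×_; _,_; proj₁; proj₂)
  open import Data.Sum using (inj₁; inj₂)
  open import Data.Empty using (⊥; ⊥-elim)
  open import Relation.Nullary using (¬_; Dec; yes; no; _×-dec_; _→-dec_; ¬?)
  open import Relation.Nullary.Decidable using (decidable-stable)
  open import Function.Bundles using (_⇔_; mk⇔; module Equivalence)
  open Equivalence using (to)
  open import Relation.Binary.PropositionalEquality using (_≡_; _≢_; refl; sym; trans; cong; subst)

  allSubsets : ∀ n → List (Subset n)
  allSubsets zero = [ [] ]
  allSubsets (suc n) = map (true ∷_) (allSubsets n) ++ map (false ∷_) (allSubsets n)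

  allSubsets-complete : ∀ {n} (S : Subset n) → S ∈ˡ allSubsets n
  allSubsets-complete [] = here refl
  allSubsets-complete {suc n} (true ∷ S) = ∈-++⁺ˡ (∈-map⁺ (true ∷_) (allSubsets-complete S))
  allSubsets-complete {suc n} (false ∷ S) = ∈-++⁺ʳ (map (true ∷_) (allSubsets n)) (∈-map⁺ (false ∷_) (allSubsets-complete S))

  module Construct {n : ℕ} (G : Graph n) where

    NoCutVertex? : ∀ S → Dec (NoCutVertex G S)
    NoCutVertex? S with Connected? G S | all? (λ x → (x ∈? S) →-dec Connected? G (S ─ ⁅ x ⁆))
    ... | yes c | yes a = yes (c , λ x h → a x h)
    ... | no nc | _ = no λ z → nc (proj₁ z)
    ... | _ | no na = no λ z → na λ x h → proj₂ z x h

    Block? : ∀ S → Dec (Block G S)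
    Block? S with NoCutVertex? S | anySubset? {P = λ T → S ⊆ T × NoCutVertex G T × ¬ T ⊆ S} (λ T → (S ⊆? T) ×-dec NoCutVertex? T ×-dec ¬? (T ⊆? S))
    ... | no nn | _ = no λ b → nn (proj₁ b)
    ... | yes _ | yes (T , st , nt , nts) = no λ b → nts (proj₂ b T st nt)
    ... | yes nc | no nT = yes (nc , λ T st nt → decidable-stable (T ⊆? S) λ nts → nT (T , st , nt , nts))

    Component? : ∀ R C → Dec (Component G R C)
    Component? R C with nonempty? C | C ⊆? R | Connected? G C
                      | anySubset? {P = λ T → C ⊆ T × T ⊆ R × Connected G T × ¬ T ⊆ C} (λ T → (C ⊆? T) ×-dec (T ⊆? R) ×-dec Connected? G T ×-dec ¬? (T ⊆? C))
    ... | no a | _ | _ | _ = no λ z → a (proj₁ z)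
    ... | yes _ | no b | _ | _ = no λ z → b (proj₁ (proj₂ z))
    ... | yes _ | yes _ | no c | _ = no λ z → c (proj₁ (proj₂ (proj₂ z)))
    ... | yes _ | yes _ | yes _ | yes (T , a , b , c , d) = no λ z → d (proj₂ (proj₂ (proj₂ z)) T a b c)
    ... | yes a | yes b | yes c | no d = yes (a , b , c , λ T ct tr tc → decidable-stable (T ⊆? C) λ ntc → d (T , ct , tr , tc , ntc))

    reachSet : Subset n → Fin n → Subset n
    reachSet R s = subsetOf (Reach? G R s)

    reachSet⁺ : ∀ {R s y} → Reach G R s y → y ∈ reachSet R s
    reachSet⁺ {R} {s} = subsetOf⁺ (Reach? G R s)

    reachSet⁻ : ∀ {R s y} → y ∈ reachSet R s → Reach G R s y
    reachSet⁻ {R} {s} = subsetOf⁻ (Reach? G R s)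

    reachInSet : ∀ {R s y t} → Reach G R s y → Reach G R y t → Reach G (reachSet R s) y t
    reachInSet rsy (here h) = here (reachSet⁺ rsy)
    reachInSet rsy (step h e r) = step (reachSet⁺ rsy) e (reachInSet (reach-snoc G rsy e (reach-start G r)) r)

    reachComp : ∀ {R s} → s ∈ R → Component G R (reachSet R s)
    reachComp {R} {s} hs = (s , reachSet⁺ (here hs)) , (λ h → reach-end G (reachSet⁻ {R} {s} h)) , conn , maximal
      where
      C = reachSet R s
      toS : ∀ {y} → y ∈ C → Reach G C s y
      toS h = reachInSet (here hs) (reachSet⁻ h)
      conn : Connected G C
      conn a b ha hb = reach-trans G (reach-sym G (toS ha)) (toS hb)
      maximal : ∀ T → C ⊆ T → T ⊆ R → Connected G T → T ⊆ C
      maximal T ct tr tc {t} ht = reachSet⁺ (reach-mono G tr (tc s t (ct (reachSet⁺ (here hs))) ht))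

    disconnected-witness : ∀ {R : Subset n} → ¬ Connected G R → ∃ λ s → ∃ λ t → s ∈ R × t ∈ R × ¬ Reach G R s t
    disconnected-witness {R} nc with all? (λ s → all? (λ t → (s ∈? R) →-dec ((t ∈? R) →-dec Reach? G R s t)))
    ... | yes a = ⊥-elim (nc λ s t hs ht → a s t hs ht)
    ... | no na with ¬∀⟶∃¬ n _ (λ s → all? (λ t → (s ∈? R) →-dec ((t ∈? R) →-dec Reach? G R s t))) na
    ...   | s , ns with ¬∀⟶∃¬ n _ (λ t → (s ∈? R) →-dec ((t ∈? R) →-dec Reach? G R s t)) ns
    ...     | t , nt with s ∈? R | t ∈? R
    ...       | no nsR | _ = ⊥-elim (nt λ h → ⊥-elim (nsR h))
    ...       | yes _ | no ntR = ⊥-elim (nt λ _ h → ⊥-elim (ntR h))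
    ...       | yes hs | yes ht = s , t , hs , ht , λ r → nt λ _ _ → r

    module Split {H : Subset n} {u v : Fin n} (ncvH : NoCutVertex G H) (se : SepEdge G H u v) where
      uH = proj₁ se
      vH = proj₁ (proj₂ se)
      euv = proj₁ (proj₂ (proj₂ se))
      ncR = proj₂ (proj₂ (proj₂ se))
      R = H ─ (⁅ u ⁆ ∪ ⁅ v ⁆)
      UV = ⁅ u ⁆ ∪ ⁅ v ⁆

      module _ {C : Subset n} (cp : Component G R C) where
        P = C ∪ UV

        outsideVertex : ∃ λ y → y ∈ R × y ∉ C
        outsideVertex with disconnected-witness ncR
        ... | s , t , hs , ht , nr with s ∈? C | t ∈? C
        ...   | no nsC | _ = s , hs , nsC
        ...   | yes _ | no ntC = t , ht , ntC
        ...   | yes sC | yes tC = ⊥-elim (nr (reach-mono G (Comp⊆ G cp) (proj₁ (proj₂ (proj₂ cp)) s t sC tC)))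

        P⊆H : P ⊆ H
        P⊆H h with ∈∪uv⁻ C h
        ... | inj₁ hc = proj₁ (∈─uv⁻ (Comp⊆ G cp hc))
        ... | inj₂ (inj₁ refl) = uH
        ... | inj₂ (inj₂ refl) = vH

        smaller : ∣ P ∣ < ∣ H ∣
        smaller with outsideVertex
        ... | y , yR , yC = p⊂q⇒∣p∣<∣q∣ (P⊆H , y , proj₁ (∈─uv⁻ yR) , yP)
          where
          yP : y ∉ P
          yP h with ∈∪uv⁻ C h | ∈─uv⁻ yR
          ... | inj₁ hc | _ = yC hc
          ... | inj₂ (inj₁ refl) | _ , yu , _ = yu refl
          ... | inj₂ (inj₂ refl) | _ , _ , yv = yv refl

        -- removing an end x of the separating edge xy: a vertex w ∈ C reaches y within
        -- H ─ {x}, and the walk enters {x, y} at y after running inside C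
        cutEnd : ∀ x y → x ∈ UV → y ∈ UV → x ≢ y → (∀ q → q ∈ UV → q ≢ x → q ≡ y) → Edge G x y → Connected G (P ─ ⁅ x ⁆)
        cutEnd x y xU yU xy other' exy s t hs ht = reach-trans G (toY s hs) (reach-sym G (toY t ht))
          where
          xH : x ∈ H
          xH = P⊆H (∈∪uv⁺ (inj₂ (∈uv⁻ xU)))
          yH : y ∈ H
          yH = P⊆H (∈∪uv⁺ (inj₂ (∈uv⁻ yU)))
          yPx : y ∈ P ─ ⁅ x ⁆
          yPx = ∈─⁅⁆⁺ (∈∪uv⁺ (inj₂ (∈uv⁻ yU))) (λ e → xy (sym e))
          Cx : ∀ {w} → w ∈ C → w ∈ P ─ ⁅ x ⁆
          Cx {w} hw = ∈─⁅⁆⁺ (∈∪uv⁺ (inj₁ hw)) λ e → notUV (subst (_∈ UV) (sym e) xU)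
            where
            notUV : w ∈ UV → ⊥
            notUV h with ∈uv⁻ h | ∈─uv⁻ (Comp⊆ G cp hw)
            ... | inj₁ refl | _ , a , _ = a refl
            ... | inj₂ refl | _ , _ , b = b refl
          toY : ∀ w → w ∈ P ─ ⁅ x ⁆ → Reach G (P ─ ⁅ x ⁆) w y
          toY w hw with ∈─⁅⁆⁻ hw
          ... | wP , wx with ∈∪uv⁻ C wP
          ...   | inj₂ wuv = subst (λ z → Reach G (P ─ ⁅ x ⁆) z y) (sym (other' w (∈uv⁺ wuv) wx)) (here yPx)
          ...   | inj₁ wC with exitEdge G {R = UV} (proj₂ ncvH x xH w y (∈─⁅⁆⁺ (P⊆H wP) wx) (∈─⁅⁆⁺ yH (λ e → xy (sym e))))
                                   (λ h → proj₂ (∈─⁻ H UV (Comp⊆ G cp wC)) h) yU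
          ...     | p , q , rp , epq , qU , qHx = reach-snoc G pre epq' yPx
            where
            rp' : Reach G R w p
            rp' = reach-mono G (λ h → let (a , b) = ∈─⁻ (H ─ ⁅ x ⁆) UV h in x∈p∧x∉q⇒x∈p─q (proj₁ (∈─⁅⁆⁻ a)) b) rp
            pre : Reach G (P ─ ⁅ x ⁆) w p
            pre = reach-mono G Cx (compWalk G cp wC rp')
            epq' : Edge G p y
            epq' = subst (Edge G p) (other' q qU (proj₂ (∈─⁅⁆⁻ qHx))) epq

        -- removing x ∈ C: a vertex w ∈ C reaches some y outside C within H ─ {x}, and the walk
        -- leaves C towards {u, v}
        cutC : ∀ x → x ∈ C → Connected G (P ─ ⁅ x ⁆)
        cutC x xC s t hs ht = reach-trans G (toU s hs) (reach-sym G (toU t ht))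
          where
          xR = Comp⊆ G cp xC
          notx : ∀ {w} → w ∈ UV → w ≢ x
          notx wU refl with ∈uv⁻ wU | ∈─uv⁻ xR
          ... | inj₁ refl | _ , a , _ = a refl
          ... | inj₂ refl | _ , _ , b = b refl
          uPx : u ∈ P ─ ⁅ x ⁆
          uPx = ∈─⁅⁆⁺ (∈∪uv⁺ (inj₂ (inj₁ refl))) (notx (∈uv⁺ (inj₁ refl)))
          UVP : ∀ {w} → w ∈ UV → w ∈ P ─ ⁅ x ⁆
          UVP wU = ∈─⁅⁆⁺ (∈∪uv⁺ (inj₂ (∈uv⁻ wU))) (notx wU)
          qToU : ∀ {q} → q ∈ UV → Reach G (P ─ ⁅ x ⁆) q u
          qToU qU with ∈uv⁻ qU
          ... | inj₁ refl = here uPx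
          ... | inj₂ refl = reach-edge G (UVP qU) uPx (Edge-sym G euv)
          toU : ∀ w → w ∈ P ─ ⁅ x ⁆ → Reach G (P ─ ⁅ x ⁆) w u
          toU w hw with ∈─⁅⁆⁻ hw
          ... | wP , wx with ∈∪uv⁻ C wP
          ...   | inj₂ wuv = qToU (∈uv⁺ wuv)
          ...   | inj₁ wC with outsideVertex
          ...     | y , yR , yC with exitEdge G {R = ∁ C} (proj₂ ncvH x (P⊆H (∈∪uv⁺ (inj₁ xC))) w y (∈─⁅⁆⁺ (P⊆H wP) wx) (∈─⁅⁆⁺ (proj₁ (∈─uv⁻ yR)) (λ e → yC (subst (_∈ C) (sym e) xC))))
                                    (x∈p⇒x∉∁p wC) (x∉p⇒x∈∁p yC)
          ...       | p , q , rp , epq , qnC , qHx = reach-trans G pre (step (reach-end G pre) epq (qToU qU))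
            where
            inC : ∀ {z} → z ∈ (H ─ ⁅ x ⁆) ─ ∁ C → z ∈ P ─ ⁅ x ⁆
            inC h with ∈─⁻ (H ─ ⁅ x ⁆) (∁ C) h
            ... | a , b = ∈─⁅⁆⁺ (∈∪uv⁺ (inj₁ (x∉∁p⇒x∈p b))) (proj₂ (∈─⁅⁆⁻ a))
            pre : Reach G (P ─ ⁅ x ⁆) w p
            pre = reach-mono G inC rp
            pC : p ∈ C
            pC = x∉∁p⇒x∈p (proj₂ (∈─⁻ (H ─ ⁅ x ⁆) (∁ C) (reach-end G rp)))
            qU : q ∈ UV
            qU with q ∈? UV
            ... | yes h = h
            ... | no nq = ⊥-elim (x∈∁p⇒x∉p qnC (compStep G cp pC (x∈p∧x∉q⇒x∈p─q (proj₁ (∈─⁅⁆⁻ qHx)) nq) epq))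

        split-noCutVertex : NoCutVertex G P
        split-noCutVertex = splitPiece-connected G (proj₁ ncvH) uH vH euv cp , cut
          where
          cut : ∀ x → x ∈ P → Connected G (P ─ ⁅ x ⁆)
          cut x hx with ∈∪uv⁻ C hx
          ... | inj₁ xC = cutC x xC
          ... | inj₂ (inj₁ refl) = cutEnd x v (∈uv⁺ (inj₁ refl)) (∈uv⁺ (inj₂ refl)) (Edge-≢ G euv) oth euv
            where
            oth : ∀ q → q ∈ UV → q ≢ x → q ≡ v
            oth q qU qx with ∈uv⁻ qU
            ... | inj₁ e = ⊥-elim (qx e)
            ... | inj₂ e = e
          ... | inj₂ (inj₂ refl) = cutEnd x u (∈uv⁺ (inj₂ refl)) (∈uv⁺ (inj₁ refl)) (λ e → Edge-≢ G euv (sym e)) oth (Edge-sym G euv)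
            where
            oth : ∀ q → q ∈ UV → q ≢ x → q ≡ u
            oth q qU qx with ∈uv⁻ qU
            ... | inj₁ e = e
            ... | inj₂ e = ⊥-elim (qx e)

      M : List (Subset n)
      M = map (λ C → C ∪ UV) (filter (Component? R) (allSubsets n))

      Miff : ∀ S → S ∈ˡ M ⇔ (∃[ C ] Component G R C × S ≡ C ∪ UV)
      Miff S = mk⇔ fw bw
        where
        fw : S ∈ˡ M → ∃[ C ] Component G R C × S ≡ C ∪ UV
        fw m with ∈-map⁻ (λ C → C ∪ UV) m
        ... | C , mC , eq = C , proj₂ (∈-filter⁻ (Component? R) {xs = allSubsets n} mC) , eq
        bw : (∃[ C ] Component G R C × S ≡ C ∪ UV) → S ∈ˡ M
        bw (C , cp , refl) = ∈-map⁺ (λ C → C ∪ UV) (∈-filter⁺ (Component? R) (allSubsets-complete C) cp)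

      Mgood : All (λ P → ∣ P ∣ < ∣ H ∣ × NoCutVertex G P) M
      Mgood = All-tab λ {S} m → piece-good (to (Miff S) m)
        where
        piece-good : ∀ {S} → (∃[ C ] Component G R C × S ≡ C ∪ UV) → ∣ S ∣ < ∣ H ∣ × NoCutVertex G S
        piece-good (C , cp , refl) = smaller cp , split-noCutVertex cp

    FinalP : Subset n → Set
    FinalP P = (∀ x → x ∈ P → Connected G (P ─ ⁅ x ⁆)) × (∀ u v → ¬ SepEdge G P u v)

    Good : ℕ → Subset n → Set
    Good s P = ∣ P ∣ < s × NoCutVertex G P

    Res : List (Subset n) → Set
    Res Ms = Σ (List (Subset n)) λ D → (∀ L₁ L₂ → Reachable G (L₁ ++ Ms ++ L₂) → Reachable G (L₁ ++ D ++ L₂)) × All FinalP D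

    SepEdge? : ∀ H u v → Dec (SepEdge G H u v)
    SepEdge? H u v = (u ∈? H) ×-dec (v ∈? H) ×-dec Edge? G u v ×-dec ¬? (Connected? G (H ─ (⁅ u ⁆ ∪ ⁅ v ⁆)))

    mutual
      process : ∀ s H → Good s H → Res [ H ]
      process zero H (() , _)
      process (suc s) H (lt , ncv) with any? (λ u → any? (λ v → SepEdge? H u v))
      ... | no nse = [ H ] , (λ L₁ L₂ r → r) , (proj₂ ncv , λ u v se → nse (u , v , se)) ∷ []
      ... | yes (u , v , se) with processList s (Split.M ncv se) (All-map (λ (a , b) → <-≤-trans a (≤-pred lt) , b) (Split.Mgood ncv se))
        where open import Data.Nat.Properties using (≤-pred)
      ...   | D , rD , fD = D , (λ L₁ L₂ r → rD L₁ L₂ (split L₁ H L₂ u v (Split.M ncv se) r se (Split.Miff ncv se))) , fD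

      processList : ∀ s Ms → All (Good s) Ms → Res Ms
      processList s [] [] = [] , (λ L₁ L₂ r → r) , []
      processList s (P ∷ Ms) (g ∷ gs) with process s P g | processList s Ms gs
      ... | D1 , r1 , f1 | D2 , r2 , f2 = D1 ++ D2 , reach , AllP.++⁺ f1 f2
        where
        import Data.List.Relation.Unary.All.Properties as AllP
        reach : ∀ L₁ L₂ → Reachable G (L₁ ++ P ∷ Ms ++ L₂) → Reachable G (L₁ ++ (D1 ++ D2) ++ L₂)
        reach L₁ L₂ r = subst (Reachable G) reassoc₂ (r2 (L₁ ++ D1) L₂ (subst (Reachable G) reassoc₁ (r1 L₁ (Ms ++ L₂) r)))
          where
          reassoc₁ : L₁ ++ D1 ++ Ms ++ L₂ ≡ (L₁ ++ D1) ++ Ms ++ L₂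
          reassoc₁ = sym (++-assoc L₁ D1 (Ms ++ L₂))
          reassoc₂ : (L₁ ++ D1) ++ D2 ++ L₂ ≡ L₁ ++ (D1 ++ D2) ++ L₂
          reassoc₂ = trans (++-assoc L₁ D1 (D2 ++ L₂)) (cong (L₁ ++_) (sym (++-assoc D1 D2 L₂)))

    Blocks : List (Subset n)
    Blocks = filter Block? (allSubsets n)

    Blocks-iff : ∀ S → S ∈ˡ Blocks ⇔ Block G S
    Blocks-iff S = mk⇔ (λ m → proj₂ (∈-filter⁻ Block? {xs = allSubsets n} m)) (λ b → ∈-filter⁺ Block? (allSubsets-complete S) b)

    decomposition : ∃ λ L → Decomposition G L
    decomposition with processList (suc n) Blocks (All-tab λ {S} m → s≤s (∣p∣≤n S) , proj₁ (to (Blocks-iff S) m))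
    ... | D , rD , fD = D , subst (Reachable G) (++-identityʳ D) (rD [] [] (subst (Reachable G) (sym (++-identityʳ Blocks)) (start Blocks Blocks-iff))) ,
                        λ H m → All-lookup fD m

    extendBlock : ∀ f S → n < f + ∣ S ∣ → NoCutVertex G S → ∃ λ B → Block G B × S ⊆ B
    extendBlock zero S lt nc = ⊥-elim (<⇒≱ lt (∣p∣≤n S))
      where open import Data.Nat.Properties using (<⇒≱)
    extendBlock (suc f) S lt nc with anySubset? {P = λ T → S ⊆ T × NoCutVertex G T × ¬ T ⊆ S} (λ T → (S ⊆? T) ×-dec NoCutVertex? T ×-dec ¬? (T ⊆? S))
    ... | no nT = S , (nc , λ T st nt → decidable-stable (T ⊆? S) λ nts → nT (T , st , nt , nts)) , λ h → h
    ... | yes (T , st , nt , nts) with ¬∀⟶∃¬ n _ (λ x → (x ∈? T) →-dec (x ∈? S)) (λ a → nts λ {x} h → a x h)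
    ...   | x , nx with x ∈? T | x ∈? S
    ...     | no nxT | _ = ⊥-elim (nx λ h → ⊥-elim (nxT h))
    ...     | yes _ | yes xS = ⊥-elim (nx λ _ → xS)
    ...     | yes xT | no nxS with extendBlock f T lt' nt
      where
      lt' : n < f + ∣ T ∣
      lt' = <-≤-trans lt (subst (_≤ f + ∣ T ∣) (+-suc f ∣ S ∣) (+-monoʳ-≤ f (p⊂q⇒∣p∣<∣q∣ (st , x , xT , nxS))))
        where open import Data.Nat.Properties using (+-suc; +-monoʳ-≤)
    ...       | B , bl , TB = B , bl , λ h → TB (st h)

-- Induced cycles survive the decomposition: an induced cycle has no cut vertex, so it lies in
-- a block; and if it lies in a piece H that is split along an edge uv, its vertices other
-- than u, v induce a connected subgraph (a path, or the whole cycle) of H ─ {u,v}, so the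
-- cycle lies in one of the new pieces C ∪ {u,v}.  Hence it lies in some final piece.
module Survival where

  open import Defs
  open Basics
  open Paths
  open CycleLists
  open Extraction
  open Splitting
  open Existence
  open import Data.Nat using (ℕ; zero; suc; s≤s)
  open import Data.Fin using (Fin; zero; suc; _≟_)
  open import Data.Fin.Subset using (Subset; _∈_; _∪_; _─_; ⁅_⁆; inside)
  open import Data.List using (List; []; _∷_; _++_; [_])
  open import Data.List.Relation.Unary.All using (All; []; _∷_) renaming (lookup to All-lookup; tabulate to All-tab; map to All-map)
  open import Data.List.Relation.Unary.Any using (Any; here; there)
  open import Data.List.Membership.Propositional using () renaming (_∈_ to _∈ˡ_; _∉_ to _∉ˡ_)
  open import Data.List.Membership.Propositional.Properties using (∈-++⁺ˡ; ∈-++⁺ʳ; ∈-++⁻)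
  open import Data.Product using (∃; _×_; _,_; proj₁; proj₂)
  open import Data.Sum using (inj₁; inj₂)
  open import Data.Empty using (⊥-elim)
  open import Relation.Nullary using (Dec; yes; no)
  open import Function.Bundles using (Equivalence)
  open import Relation.Binary.PropositionalEquality using (_≢_; refl; sym; subst)

  module _ {n : ℕ} (G : Graph n) where
    open Construct G

    IPath-reach-head : ∀ {S : Subset n} {h} q → IPath G (h ∷ q) → All (_∈ S) (h ∷ q) → ∀ {w} → w ∈ˡ h ∷ q → Reach G S w h
    IPath-reach-head q ip (hS ∷ _) (here refl) = here hS
    IPath-reach-head (h2 ∷ q) (e , _ , _ , ip) (hS ∷ al) (there m) = reach-snoc G (IPath-reach-head q ip al m) (Edge-sym G e) hS

    IPath-connected : ∀ {S : Subset n} q → IPath G q → All (_∈ S) q → ∀ {s t} → s ∈ˡ q → t ∈ˡ q → Reach G S s t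
    IPath-connected (h ∷ q) ip al ms mt = reach-trans G (IPath-reach-head q ip al ms) (reach-sym G (IPath-reach-head q ip al mt))

    ICycle-connected : ∀ {S : Subset n} {v p} → ICycle G v p → All (_∈ S) (v ∷ p) → ∀ {s t} → s ∈ˡ v ∷ p → t ∈ˡ v ∷ p → Reach G S s t
    ICycle-connected {S} {v} {a ∷ q} (ip , _ , eva , _) (vS ∷ al) ms mt = reach-trans G (toA ms) (reach-sym G (toA mt))
      where
      toA : ∀ {w} → w ∈ˡ v ∷ a ∷ q → Reach G S w a
      toA (here refl) = reach-edge G vS (All-lookup al (here refl)) eva
      toA (there m) = IPath-reach-head q ip al m

    -- an induced cycle has no cut vertex: removing w leaves the induced path after w
    ICycle-noCutVertex : ∀ {v p} → ICycle G v p → NoCutVertex G (fromList (v ∷ p))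
    ICycle-noCutVertex {v} {p} c = (λ s t hs ht → ICycle-connected c (All-tab fromList⁺) (fromList⁻ hs) (fromList⁻ ht)) , cut
      where
      cl = v ∷ p
      cut : ∀ w → w ∈ fromList cl → Connected G (fromList cl ─ ⁅ w ⁆)
      cut w hw s t hs ht with rotateTo G c (fromList⁻ hw)
      ... | L , (ipL , wnin , _) , back , fwd = IPath-connected L ipL alL (inL hs) (inL ht)
        where
        alL : All (_∈ fromList cl ─ ⁅ w ⁆) L
        alL = All-tab λ {z} m → ∈─⁅⁆⁺ (fromList⁺ (back (there m))) (λ e → wnin (subst (_∈ˡ L) e m))
        inL : ∀ {z} → z ∈ fromList cl ─ ⁅ w ⁆ → z ∈ˡ L
        inL h with ∈─⁅⁆⁻ h
        ... | h1 , zw with fwd (fromList⁻ h1)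
        ...   | here e = ⊥-elim (zw e)
        ...   | there m = m

    Remainder : Subset n → Fin n → Fin n → List (Fin n) → Set
    Remainder S u v cl = ∃ λ s → s ∈ S × (∀ {w} → w ∈ˡ cl → w ≢ u → w ≢ v → Reach G S s w)

    remainderViaPath : ∀ {S u v cl} → (∀ {w} → w ∈ˡ cl → w ≢ u → w ≢ v → w ∈ S) →
                       ∀ q → IPath G q → (∀ {w} → w ∈ˡ q → w ∈ˡ cl × w ≢ u × w ≢ v) →
                       (∀ {w} → w ∈ˡ cl → w ≢ u → w ≢ v → w ∈ˡ q) → ∀ {s} → s ∈ˡ q → Remainder S u v cl
    remainderViaPath {S} inS q ip inq covers {s} ms =
      s , onS ms , λ m w≢u w≢v → IPath-connected q ip (All-tab onS) ms (covers m w≢u w≢v)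
      where
      onS : ∀ {w} → w ∈ˡ q → w ∈ S
      onS m with inq m
      ... | m' , w≢u , w≢v = inS m' w≢u w≢v

    Remainder-swap : ∀ {S u v cl} → Remainder S u v cl → Remainder S v u cl
    Remainder-swap (s , sS , reach) = s , sS , λ m w≢v w≢u → reach m w≢u w≢v

    -- u on the cycle: rotated to start at u, the cycle is u, a, …, b with a, b the neighbours
    -- of u on it, so the other vertices form the induced path a … b, minus v if v ∈ {a, b}
    remainderAt : ∀ {S : Subset n} {u v c0 p} → ICycle G c0 p → Edge G u v →
                  (∀ {w} → w ∈ˡ c0 ∷ p → w ≢ u → w ≢ v → w ∈ S) →
                  u ∈ˡ c0 ∷ p → Dec (v ∈ˡ c0 ∷ p) → Remainder S u v (c0 ∷ p)
    remainderAt {S} {u} {v} {c0} {p} c euv inS u∈ v? with rotateTo G c u∈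
    ... | [] , (_ , _ , ()) , _
    ... | (a ∷ L') , (ipL , u∉full , eua , la) , back , fwd with OnlyLast-view G la
    ...   | L'' , b , refl , naL , eub = withV v?
      where
      full = a ∷ L'' ++ [ b ]
      dropU : ∀ {w} → w ∈ˡ u ∷ full → w ≢ u → w ∈ˡ full
      dropU (here e) ne = ⊥-elim (ne e)
      dropU (there m) _ = m
      notU : ∀ {w} → w ∈ˡ full → w ≢ u
      notU m refl = u∉full m
      withV : Dec (v ∈ˡ c0 ∷ p) → Remainder S u v (c0 ∷ p)
      withV (no v∉) =
        remainderViaPath inS full ipL (λ m → back (there m) , notU m , (λ { refl → v∉ (back (there m)) }))
          (λ m w≢u _ → dropU (fwd m) w≢u) (here refl)
      withV (yes v∈) with fwd v∈
      ... | here e = ⊥-elim (Edge-≢ G euv (sym e))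
      ... | there (here refl) =
              remainderViaPath inS (L'' ++ [ b ]) (IPath-tail G ipL)
                (λ m → back (there (there m)) , notU (there m) , (λ { refl → IPath-head∉ G ipL m }))
                (λ m w≢u w≢v → dropA (dropU (fwd m) w≢u) w≢v) (∈-++⁺ʳ L'' (here refl))
        where
        dropA : ∀ {w} → w ∈ˡ full → w ≢ v → w ∈ˡ L'' ++ [ b ]
        dropA (here e) ne = ⊥-elim (ne e)
        dropA (there m) _ = m
      ... | there (there m) with ∈-++⁻ L'' m
      ...   | inj₁ m' = ⊥-elim (All-lookup naL m' euv)
      ...   | inj₂ (here refl) =
              remainderViaPath inS (a ∷ L'') (proj₁ (IPath-++⁻ G (a ∷ L'') ipL))
                (λ m → back (there (∈-++⁺ˡ m)) , notU (∈-++⁺ˡ m) , (λ { refl → IPath-last∉ G (a ∷ L'') ipL m }))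
                (λ m w≢u w≢v → dropB (dropU (fwd m) w≢u) w≢v) (here refl)
        where
        dropB : ∀ {w} → w ∈ˡ full → w ≢ v → w ∈ˡ a ∷ L''
        dropB m ne with ∈-++⁻ (a ∷ L'') m
        ... | inj₁ m2 = m2
        ... | inj₂ (here e) = ⊥-elim (ne e)

    cycle─edge-remainder : ∀ {S : Subset n} {u v c0 p} → ICycle G c0 p → Edge G u v →
                           (∀ {w} → w ∈ˡ c0 ∷ p → w ≢ u → w ≢ v → w ∈ S) → Remainder S u v (c0 ∷ p)
    cycle─edge-remainder {S} {u} {v} {c0} {p} c euv inS with u ∈ˡ? (c0 ∷ p) | v ∈ˡ? (c0 ∷ p)
    ... | yes u∈ | v? = remainderAt c euv inS u∈ v?
    ... | no u∉ | yes v∈ = Remainder-swap (remainderAt c (Edge-sym G euv) (λ m w≢v w≢u → inS m w≢u w≢v) v∈ (no u∉))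
    ... | no u∉ | no v∉ =
          c0 , inS (here refl) (avoid u∉ (here refl)) (avoid v∉ (here refl)) ,
          λ m _ _ → ICycle-connected c (All-tab λ m' → inS m' (avoid u∉ m') (avoid v∉ m')) (here refl) m
      where
      avoid : ∀ {x w} → x ∉ˡ c0 ∷ p → w ∈ˡ c0 ∷ p → w ≢ x
      avoid x∉ m refl = x∉ m

    cycle-survives-split : ∀ {H : Subset n} {u v} {c0 p} → ICycle G c0 p → All (_∈ H) (c0 ∷ p) → Edge G u v →
                           ∃ λ C → Component G (H ─ (⁅ u ⁆ ∪ ⁅ v ⁆)) C × All (_∈ C ∪ (⁅ u ⁆ ∪ ⁅ v ⁆)) (c0 ∷ p)
    cycle-survives-split {H} {u} {v} {c0} {p} c inH euv
      with cycle─edge-remainder {S = H ─ (⁅ u ⁆ ∪ ⁅ v ⁆)} c euv (λ m w≢u w≢v → ∈─uv⁺ (All-lookup inH m) w≢u w≢v)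
    ... | s , sR , reach = reachSet R s , reachComp sR , All-tab inPiece
      where
      R = H ─ (⁅ u ⁆ ∪ ⁅ v ⁆)
      inPiece : ∀ {w} → w ∈ˡ c0 ∷ p → w ∈ reachSet R s ∪ (⁅ u ⁆ ∪ ⁅ v ⁆)
      inPiece {w} m with w ≟ u | w ≟ v
      ... | yes e | _ = ∈∪uv⁺ (inj₂ (inj₁ e))
      ... | no _ | yes e = ∈∪uv⁺ (inj₂ (inj₂ e))
      ... | no w≢u | no w≢v = ∈∪uv⁺ (inj₁ (reachSet⁺ (reach m w≢u w≢v)))

    cycle-in-piece : ∀ {L} → Reachable G L → ∀ {v p} → ICycle G v p → ∃ λ H → H ∈ˡ L × All (_∈ H) (v ∷ p)
    cycle-in-piece (start L iff) {v} {p} c with extendBlock (suc n) (fromList (v ∷ p)) (s≤s (m≤m+n n _)) (ICycle-noCutVertex c)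
      where open import Data.Nat.Properties using (m≤m+n)
    ... | B , bl , shortcut = B , Equivalence.from (iff B) bl , All-tab λ m → shortcut (fromList⁺ m)
    cycle-in-piece (split L₁ H L₂ u v M r se iff) c with cycle-in-piece r c
    ... | H' , m , al with ∈-++⁻ L₁ m
    ...   | inj₁ m1 = H' , ∈-++⁺ˡ m1 , al
    ...   | inj₂ (there m2) = H' , ∈-++⁺ʳ L₁ (∈-++⁺ʳ M m2) , al
    ...   | inj₂ (here refl) with cycle-survives-split c al (proj₁ (proj₂ (proj₂ se)))
    ...     | C , cp , al' = C ∪ (⁅ u ⁆ ∪ ⁅ v ⁆) , ∈-++⁺ʳ L₁ (∈-++⁺ˡ (Equivalence.from (iff _) (C , cp , refl))) , al'

module Main where

  open import Defs
  open CycleLists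
  open FinalPieces
  open Splitting
  open CycleLength
  open Existence
  open Survival
  open import Data.Nat using (ℕ; zero; suc; _≤_; _+_)
  open import Data.Fin using (Fin)
  open import Data.Fin.Subset using (Subset; ⊤; _∈_)
  open import Data.List.Membership.Propositional using () renaming (_∈_ to _∈ˡ_)
  open import Data.List.Relation.Unary.All using () renaming (lookup to All-lookup)
  open import Data.Sum using (_⊎_; inj₁; inj₂)
  open import Data.Empty using (⊥-elim)
  open import Data.Product using (_,_)
  open import Function.Bundles using (module Equivalence)
  open Equivalence using (to)
  open import Relation.Binary.PropositionalEquality using (_≡_; _≢_; subst)

  SC⇒pieces : ∀ {n} (G : Graph n) (k : ℕ) → SC G k → k ≢ 3 → (∀ q → q + q ≢ k) → 2 ≤ n → Connected G ⊤ →
              ∀ L → Decomposition G L → ∀ H → H ∈ˡ L → IsK2 G H ⊎ IsCk G k H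
  SC⇒pieces G k sc k≢3 k-odd n≥2 conn L (reachable , final) H H∈L
    with piece-invariant G n≥2 conn reachable H H∈L | final H H∈L
  ... | connH , u , v , uH , vH , u≢v | noCut , noSep =
        Shape.finalPiece-shape G k sc k≢3 k-odd H u v uH vH u≢v connH noCut noSep

  cycleInCk-length : ∀ {n} {G : Graph n} {ℓ k} {f : Fin (suc ℓ) → Fin n} {H : Subset n} →
                     IsInducedCycle G (suc ℓ) f → (∀ i → f i ∈ H) → IsCk G k H → suc ℓ ≡ k
  cycleInCk-length {k = zero} _ _ (_ , (() , _) , _)
  cycleInCk-length {G = G} {k = suc _} {f} cyc inH (g , cycg , H≡g) =
    inducedCycles-sameLength G cyc cycg (λ i → to (H≡g (f i)) (inH i))

  pieces⇒SC : ∀ {n} (G : Graph n) (k : ℕ) →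
              (∀ L → Decomposition G L → ∀ H → H ∈ˡ L → IsK2 G H ⊎ IsCk G k H) → SC G k
  pieces⇒SC {n} G k pieces = inj₂ inducedCycle-length
    where
    inducedCycle-length : ∀ ℓ (f : Fin ℓ → Fin n) → IsInducedCycle G ℓ f → ℓ ≡ k
    inducedCycle-length zero f (() , _)
    inducedCycle-length (suc ℓ) f cyc with Construct.decomposition G
    ... | L , dec@(reachable , _) with cycle-in-piece G reachable (induced⇒ICycle G cyc)
    ...   | H , H∈L , inH with pieces L dec H H∈L
    ...     | inj₁ (u , v , _ , _ , H≡uv) =
              ⊥-elim (noCycleInEdge G cyc (λ i → subst (f i ∈_) H≡uv (All-lookup inH (cycleList-∈⁺ G f i))))
    ...     | inj₂ ck = cycleInCk-length {G = G} cyc (λ i → All-lookup inH (cycleList-∈⁺ G f i)) ck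

open import Defs
open import Data.Nat using (ℕ; _≤_; _+_; _*_)
open import Data.Fin.Subset using (⊤)
open import Data.List.Membership.Propositional using () renaming (_∈_ to _∈ˡ_)
open import Data.Sum using (_⊎_)
open import Function.Bundles using (_⇔_; mk⇔)

theorem5 : ∀ (m : ℕ) → 1 ≤ m → ∀ {n : ℕ} (G : Graph n) → 2 ≤ n → Connected G ⊤ →
    (SC G (2 * m + 3)
    ⇔ (∀ L → Decomposition G L → ∀ H → H ∈ˡ L → IsK2 G H ⊎ IsCk G (2 * m + 3) H))
theorem5 m m≥1 G n≥2 conn =
  mk⇔ (λ sc → Main.SC⇒pieces G (2 * m + 3) sc (Parity.2m+3≢3 m m≥1) (Parity.2m+3-odd m) n≥2 conn)
      (Main.pieces⇒SC G (2 * m + 3))
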